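{- For every $(v_2)$ configuration $\mathcal{C}$ and every field $\mathbf F$, $wcdim(Levi_{\mathcal{C}},\mathbf F)$ is even. Moreover, for every $n\in\mathbb{N}$ there is a $(v_2)$ configuration $\mathcal{C}_n$ such that $wcdim(Levi_{\mathcal{C}_n},\mathbf F)=2n$ for every field $\mathbf F$. In particular, the sequence $\{wcdim(Levi_{\mathcal{C}_n})\}_{n=1}^\infty$ is unbounded.
   Context: A configuration is an incidence structure consisting of a set of points and a set of lines together with an incidence relation between points and lines, such that any two distinct points are incident with at most one common line and any two distinct lines are incident with at most one common point. A $(v_2)$ configuration is a configuration with exactly $v\ge 4$ points and exactly $v$ lines in which every line is incident with exactly $2$ points and every point is incident with exactly $2$ lines. The Levi graph $Levi_{\mathcal{C}}$ is the simple bipartite graph whose vertices are the points and lines of $\mathcal{C}$, with $P$ adjacent to $\ell$ iff $P$ is incident with $\ell$. For a graph $G$ and field $\mathbf F$, a weighting $f:V(G)\to\mathbf F$ is well-covered if $\sum_{x\in M}f(x)$ is the same for every maximal independent set $M$ of $G$; $wcdim(G,\mathbf F)$ is the dimension of the $\mathbf F$-vector space of well-covered weightings. -}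

module Defs where

open import Level using (Level; _⊔_; Setω) renaming (suc to lsuc)
open import Data.Nat using (ℕ; zero; suc; _≤_)
import Data.Nat as N
open import Data.Bool using (Bool; true; false; _∧_; _∨_; if_then_else_)
open import Data.Fin using (Fin; zero; suc; splitAt; _≟_)
open import Data.Sum using (_⊎_; inj₁; inj₂)
open import Data.Product using (Σ; _×_; _,_)
open import Relation.Nullary using (¬_)
open import Relation.Nullary.Decidable using (⌊_⌋)
open import Relation.Binary.PropositionalEquality using (_≡_; _≢_)
open import Algebra.Bundles using (CommutativeRing)

record Field (c ℓ : Level) : Set (lsuc (c ⊔ ℓ)) where
  field
    commutativeRing : CommutativeRing c ℓ
  open CommutativeRing commutativeRing public
  field
    1≉0     : ¬ (1# ≈ 0#)
    inverse : ∀ x → ¬ (x ≈ 0#) → Σ Carrier (λ y → (x * y) ≈ 1#)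

count : ∀ {n} → (Fin n → Bool) → ℕ
count {zero}  P = 0
count {suc n} P = (if P zero then 1 else 0) N.+ count (λ i → P (suc i))

record V2Config (v : ℕ) : Set where
  field
    four≤v      : 4 ≤ v
    inc         : Fin v → Fin v → Bool          -- point → line → incident?
    line-two    : ∀ (l : Fin v) → count (λ p → inc p l) ≡ 2
    point-two   : ∀ (p : Fin v) → count (λ l → inc p l) ≡ 2
    points-meet : ∀ (p q : Fin v) → p ≢ q → count (λ l → inc p l ∧ inc q l) ≤ 1
    lines-meet  : ∀ (l m : Fin v) → l ≢ m → count (λ p → inc p l ∧ inc p m) ≤ 1

record Graph (n : ℕ) : Set where
  field
    adj       : Fin n → Fin n → Bool
    adj-sym   : ∀ x y → adj x y ≡ adj y x
    adj-irrefl : ∀ x → adj x x ≡ false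

-- Levi graph: vertices Fin (v N.+ v); the first v are the points, the last
-- v are the lines; point p ~ line l iff p is incident with l.

leviAdj : ∀ {v} → V2Config v → Fin (v N.+ v) → Fin (v N.+ v) → Bool
leviAdj {v} C x y with splitAt v x | splitAt v y
... | inj₁ p | inj₂ l = V2Config.inc C p l
... | inj₂ l | inj₁ p = V2Config.inc C p l
... | inj₁ _ | inj₁ _ = false
... | inj₂ _ | inj₂ _ = false

leviAdj-sym : ∀ {v} (C : V2Config v) x y → leviAdj C x y ≡ leviAdj C y x
leviAdj-sym {v} C x y with splitAt v x | splitAt v y
... | inj₁ p | inj₂ l = _≡_.refl
... | inj₂ l | inj₁ p = _≡_.refl
... | inj₁ _ | inj₁ _ = _≡_.refl
... | inj₂ _ | inj₂ _ = _≡_.refl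

leviAdj-irrefl : ∀ {v} (C : V2Config v) x → leviAdj C x x ≡ false
leviAdj-irrefl {v} C x with splitAt v x
... | inj₁ _ = _≡_.refl
... | inj₂ _ = _≡_.refl

Levi : ∀ {v} → V2Config v → Graph (v N.+ v)
Levi C = record
  { adj = leviAdj C ; adj-sym = leviAdj-sym C ; adj-irrefl = leviAdj-irrefl C }

Independent : ∀ {n} → Graph n → (Fin n → Bool) → Set
Independent G M = ∀ x y → M x ≡ true → M y ≡ true → Graph.adj G x y ≡ false

insert : ∀ {n} → Fin n → (Fin n → Bool) → (Fin n → Bool)
insert x M y = ⌊ y ≟ x ⌋ ∨ M y

MaximalIndependent : ∀ {n} → Graph n → (Fin n → Bool) → Set
MaximalIndependent G M =
  Independent G M × (∀ x → M x ≡ false → ¬ Independent G (insert x M))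

module _ {c ℓ} (F : Field c ℓ) where
  open Field F using (Carrier; _≈_; _+_; _*_; 0#)

  Σᶠ : ∀ {n} → (Fin n → Carrier) → Carrier
  Σᶠ {zero}  g = 0#
  Σᶠ {suc n} g = g zero + Σᶠ (λ i → g (suc i))

  weight : ∀ {n} → (Fin n → Carrier) → (Fin n → Bool) → Carrier
  weight f M = Σᶠ (λ x → if M x then f x else 0#)

  WellCovered : ∀ {n} → Graph n → (Fin n → Carrier) → Set ℓ
  WellCovered G f = ∀ M M' → MaximalIndependent G M → MaximalIndependent G M'
                    → weight f M ≈ weight f M'

  lincomb : ∀ {n d} → (Fin d → Carrier) → (Fin d → Fin n → Carrier) → Fin n → Carrier
  lincomb a b x = Σᶠ (λ i → a i * b i x)

  IsWCBasis : ∀ {n d} → Graph n → (Fin d → Fin n → Carrier) → Set (c ⊔ ℓ)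
  IsWCBasis {n} {d} G b =
      (∀ i → WellCovered G (b i))
    × (∀ (a : Fin d → Carrier) → (∀ x → lincomb a b x ≈ 0#) → ∀ i → a i ≈ 0#)
    × (∀ f → WellCovered G f → Σ (Fin d → Carrier) (λ a → ∀ x → f x ≈ lincomb a b x))

  wcdim≡ : ∀ {n} → Graph n → ℕ → Set (c ⊔ ℓ)
  wcdim≡ {n} G d = Σ (Fin d → Fin n → Carrier) (λ b → IsWCBasis G b)

record _×ω_ (A B : Setω) : Setω where
  constructor _,ω_
  field
    fstω : A
    sndω : B

record ConfigWithWcdim (n : ℕ) : Setω where
  field
    v      : ℕ
    config : V2Config v
    dim    : ∀ {c ℓ} (F : Field c ℓ) → wcdim≡ F (Levi config) (2 N.* n)

-- The Levi graph of a (v₂) configuration is 2-regular, bipartite and has no 4-cycle, so it is a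
-- disjoint union of even cycles of length at least 6. Comparing two maximal independent sets that
-- differ only next to a vertex x shows that a well-covered weighting f satisfies
-- f(x) = f(x₊) + f(x₋) for the two neighbours x₊, x₋ of x, and even f(x) = f(x₊) when x lies on no
-- hexagon. Hence f vanishes off the hexagons and on each hexagon is determined by its values at two
-- adjacent vertices; conversely both weightings so obtained from a hexagon are well covered. Thus
-- wcdim is twice the number of hexagons, and adding a disjoint triangle adds one hexagon.

module Submission where

open import Defs
open import Data.Nat as ℕ using (ℕ; zero; suc; _≤_; z≤n; s≤s)
open import Data.Nat.Properties as ℕ using (+-suc; ≤-trans)
open import Data.Bool using (Bool; true; false; _∧_; _∨_; not; if_then_else_)
open import Data.Bool.Properties as 𝔹 using (∨-comm)
open import Data.Vec using (lookup; tabulate)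
open import Data.Vec.Properties using (lookup∘tabulate)
open import Data.Fin.Subset using (Subset)
open import Data.Fin.Subset.Properties using (anySubset?)
open import Data.Fin using (Fin; zero; suc; _≟_; toℕ; _↑ˡ_; _↑ʳ_; splitAt; join; punchIn; punchOut; combine; remQuot)
open import Data.Fin.Patterns
open import Data.Fin.Properties as Fin using (all?; any?; remQuot-combine)
open import Data.Sum using (_⊎_; inj₁; inj₂)
import Data.Sum as Sum
import Data.Sum.Properties as Sum
open import Data.Product using (Σ; ∃; ∃-syntax; _×_; _,_; proj₁; proj₂)
open import Data.Empty using (⊥; ⊥-elim)
open import Relation.Nullary using (¬_; yes; no; Dec)
open import Relation.Nullary.Decidable using (⌊_⌋; True; toWitness; fromWitness; from-yes; decidable-stable; ¬?; _⊎-dec_; _×-dec_)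
open import Relation.Binary.PropositionalEquality
open import Function.Bundles using (Equivalence)
open import Data.Vec.Functional using (removeAt)
open import Data.List using (List; []; _∷_; allFin)
open import Data.List.Membership.Propositional using (_∈_)
open import Data.List.Membership.Propositional.Properties using (∈-allFin)
open import Data.List.Relation.Unary.Any using (here; there)

false≢true : false ≢ true
false≢true ()

erase : ∀ {n} → Fin n → (Fin n → Bool) → Fin n → Bool
erase a P x = not ⌊ x ≟ a ⌋ ∧ P x

count-cong : ∀ {n} {P Q : Fin n → Bool} → (∀ i → P i ≡ Q i) → count P ≡ count Q
count-cong {zero}  eq = refl
count-cong {suc n} eq rewrite eq zero = cong (_ ℕ.+_) (count-cong (λ i → eq (suc i)))

erase-suc : ∀ {n} (P : Fin (suc n) → Bool) a i → erase (suc a) P (suc i) ≡ erase a (λ j → P (suc j)) i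
erase-suc P a i with i ≟ a
... | yes _ = refl
... | no _  = refl

count-erase : ∀ {n} (P : Fin n → Bool) a → P a ≡ true → count P ≡ suc (count (erase a P))
count-erase P zero    Pa rewrite Pa = refl
count-erase P (suc a) Pa
  rewrite count-erase (λ i → P (suc i)) a Pa | count-cong (erase-suc P a) = +-suc _ _

erase-≢ : ∀ {n} (P : Fin n → Bool) {a x} → x ≢ a → erase a P x ≡ P x
erase-≢ P {a} {x} x≢a with x ≟ a
... | yes x≡a = ⊥-elim (x≢a x≡a)
... | no _    = refl

erase-true : ∀ {n} (P : Fin n → Bool) {a x} → erase a P x ≡ true → x ≢ a × P x ≡ true
erase-true P {a} {x} e with x ≟ a
... | no x≢a = x≢a , e

count-≥1 : ∀ {n} (P : Fin n → Bool) {a} → P a ≡ true → 1 ≤ count P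
count-≥1 P {a} Pa rewrite count-erase P a Pa = s≤s z≤n

count-≥2 : ∀ {n} (P : Fin n → Bool) {a b} → P a ≡ true → P b ≡ true → a ≢ b → 2 ≤ count P
count-≥2 P {a} Pa Pb a≢b rewrite count-erase P a Pa =
  s≤s (count-≥1 (erase a P) (trans (erase-≢ P (λ b≡a → a≢b (sym b≡a))) Pb))

witness : ∀ {n} (P : Fin n → Bool) {k} → count P ≡ suc k → ∃[ a ] P a ≡ true
witness {suc n} P eq with P zero in P0
... | true  = zero , P0
... | false = let a , Pa = witness (λ i → P (suc i)) eq in suc a , Pa

record ExactlyTwo {n} (P : Fin n → Bool) : Set where
  field
    fst snd  : Fin n
    fst≢snd  : fst ≢ snd
    P-fst    : P fst ≡ true
    P-snd    : P snd ≡ true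
    fst-or-snd : ∀ z → P z ≡ true → z ≡ fst ⊎ z ≡ snd

count≡2⇒exactlyTwo : ∀ {n} (P : Fin n → Bool) → count P ≡ 2 → ExactlyTwo P
count≡2⇒exactlyTwo {n} P P≡2 = record
  { fst = a ; snd = b ; fst≢snd = λ a≡b → b≢a (sym a≡b)
  ; P-fst = Pa ; P-snd = Pb ; fst-or-snd = fst-or-snd }
  where
  a : Fin n
  a = proj₁ (witness P P≡2)
  Pa : P a ≡ true
  Pa = proj₂ (witness P P≡2)
  P′≡1 : count (erase a P) ≡ 1
  P′≡1 = ℕ.suc-injective (trans (sym (count-erase P a Pa)) P≡2)
  b : Fin n
  b = proj₁ (witness (erase a P) P′≡1)
  b≢a : b ≢ a
  b≢a = proj₁ (erase-true P (proj₂ (witness (erase a P) P′≡1)))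
  Pb : P b ≡ true
  Pb = proj₂ (erase-true P (proj₂ (witness (erase a P) P′≡1)))
  fst-or-snd : ∀ z → P z ≡ true → z ≡ a ⊎ z ≡ b
  fst-or-snd z Pz with z ≟ a | z ≟ b
  ... | yes z≡a | _       = inj₁ z≡a
  ... | no _    | yes z≡b = inj₂ z≡b
  ... | no z≢a  | no z≢b  = ⊥-elim (ℕ.<-irrefl refl (subst (2 ≤_) P′≡1
          (count-≥2 (erase a P) (proj₂ (witness (erase a P) P′≡1))
                    (trans (erase-≢ P z≢a) Pz) (λ b≡z → z≢b (sym b≡z)))))

count≤1⇒unique : ∀ {n} (P : Fin n → Bool) {a b} → count P ≤ 1 → P a ≡ true → P b ≡ true → a ≡ b
count≤1⇒unique P {a} {b} ≤1 Pa Pb with a ≟ b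
... | yes a≡b = a≡b
... | no a≢b = ⊥-elim (ℕ.<-irrefl refl (≤-trans (count-≥2 P Pa Pb a≢b) ≤1))

count-↑ : ∀ k {m} (P : Fin (k ℕ.+ m) → Bool) →
          count P ≡ count (λ i → P (i ↑ˡ m)) ℕ.+ count (λ j → P (k ↑ʳ j))
count-↑ zero    P = refl
count-↑ (suc k) P rewrite count-↑ k (λ i → P (suc i)) = sym (ℕ.+-assoc (if P zero then 1 else 0) _ _)

count-false : ∀ {n} (P : Fin n → Bool) → (∀ i → P i ≡ false) → count P ≡ 0
count-false {zero}  P _   = refl
count-false {suc n} P all rewrite all zero = count-false (λ i → P (suc i)) (λ i → all (suc i))

count-none : ∀ {n} → count {n} (λ _ → false) ≡ 0
count-none {n} = count-false {n} (λ _ → false) (λ _ → refl)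

count-∧false≤1 : ∀ {n} (P : Fin n → Bool) → count (λ i → P i ∧ false) ≤ 1
count-∧false≤1 P = subst (_≤ 1) (sym (count-false (λ i → P i ∧ false) (λ i → 𝔹.∧-zeroʳ (P i)))) z≤n

count-splitAt : ∀ k {m} (P : Fin k ⊎ Fin m → Bool) →
                count (λ i → P (splitAt k i)) ≡ count (λ i → P (inj₁ i)) ℕ.+ count (λ j → P (inj₂ j))
count-splitAt k {m} P = trans (count-↑ k (λ i → P (splitAt k i)))
  (cong₂ ℕ._+_ (count-cong λ i → cong P (Fin.splitAt-↑ˡ k i m)) (count-cong λ j → cong P (Fin.splitAt-↑ʳ k m j)))

splitAt-injective : ∀ m {k} {i j : Fin (m ℕ.+ k)} → splitAt m i ≡ splitAt m j → i ≡ j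
splitAt-injective m {k} {i} {j} e =
  trans (sym (Fin.join-splitAt m k i)) (trans (cong (join m k) e) (Fin.join-splitAt m k j))

join-injective : ∀ m {k} {u w : Fin m ⊎ Fin k} → join m k u ≡ join m k w → u ≡ w
join-injective m {k} {u} {w} e = trans (sym (Fin.splitAt-join m k u)) (trans (cong (splitAt m) e) (Fin.splitAt-join m k w))

record Enumeration {n} (P : Fin n → Bool) (m : ℕ) : Set where
  field
    elem            : Fin m → Fin n
    elem-P          : ∀ t → P (elem t) ≡ true
    elem-injective  : ∀ {t t′} → elem t ≡ elem t′ → t ≡ t′
    elem-surjective : ∀ x → P x ≡ true → ∃[ t ] elem t ≡ x

enumerate : ∀ {n} (P : Fin n → Bool) → Enumeration P (count P)
enumerate {zero} P = record { elem = λ () ; elem-P = λ () ; elem-injective = λ {} ; elem-surjective = λ () }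
enumerate {suc n} P with P zero in P0 | enumerate (λ i → P (suc i))
... | true | E = record
  { elem = λ { zero → zero ; (suc t) → suc (elem t) }
  ; elem-P = λ { zero → P0 ; (suc t) → elem-P t }
  ; elem-injective = λ { {zero} {zero} _ → refl ; {suc t} {suc t′} e → cong suc (elem-injective (Fin.suc-injective e)) }
  ; elem-surjective = λ { zero _ → zero , refl
                        ; (suc x) Px → let t , e = elem-surjective x Px in suc t , cong suc e } }
  where open Enumeration E
... | false | E = record
  { elem = λ t → suc (elem t)
  ; elem-P = elem-P
  ; elem-injective = λ e → elem-injective (Fin.suc-injective e)
  ; elem-surjective = λ { zero Px → ⊥-elim (false≢true (trans (sym P0) Px))
                        ; (suc x) Px → let t , e = elem-surjective x Px in t , cong suc e } }
  where open Enumeration E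

argmin : ∀ {k} (g : Fin (suc k) → ℕ) → ∃[ i ] ∀ j → g i ≤ g j
argmin {zero}  g = zero , λ { zero → ℕ.≤-refl }
argmin {suc k} g with argmin (λ j → g (suc j))
... | i , min with g zero ℕ.≤? g (suc i)
...   | yes g₀≤ = zero , λ { zero → ℕ.≤-refl ; (suc j) → ≤-trans g₀≤ (min j) }
...   | no g₀≰  = suc i , λ { zero → ℕ.<⇒≤ (ℕ.≰⇒> g₀≰) ; (suc j) → min j }

next prev : Fin 6 → Fin 6
next 0F = 1F
next 1F = 2F
next 2F = 3F
next 3F = 4F
next 4F = 5F
next 5F = 0F
prev 0F = 5F
prev 1F = 0F
prev 2F = 1F
prev 3F = 2F
prev 4F = 3F
prev 5F = 4F

next^ prev^ : ℕ → Fin 6 → Fin 6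
next^ zero    i = i
next^ (suc k) i = next (next^ k i)
prev^ zero    i = i
prev^ (suc k) i = prev (prev^ k i)

next-prev : ∀ i → next (prev i) ≡ i
next-prev = from-yes (all? λ i → next (prev i) ≟ i)

next²≢id : ∀ i → next (next i) ≢ i
next²≢id = from-yes (all? λ i → ¬? (next (next i) ≟ i))

prev²≢id : ∀ i → prev (prev i) ≢ i
prev²≢id = from-yes (all? λ i → ¬? (prev (prev i) ≟ i))

next≢prev : ∀ i → next i ≢ prev i
next≢prev = from-yes (all? λ i → ¬? (next i ≟ prev i))

next^6≡id : ∀ i → next^ 6 i ≡ i
next^6≡id = from-yes (all? λ i → next^ 6 i ≟ i)

prev^6≡id : ∀ i → prev^ 6 i ≡ i
prev^6≡id = from-yes (all? λ i → prev^ 6 i ≟ i)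

next^-reaches : ∀ i j → ∃[ k ] next^ (toℕ k) i ≡ j
next^-reaches = from-yes (all? λ i → all? λ j → any? λ (k : Fin 6) → next^ (toℕ k) i ≟ j)

prev^-reaches : ∀ i j → ∃[ k ] prev^ (toℕ k) i ≡ j
prev^-reaches = from-yes (all? λ i → all? λ j → any? λ (k : Fin 6) → prev^ (toℕ k) i ≟ j)

hexagon-distances : ∀ i j → i ≡ j ⊎ j ≡ next i ⊎ i ≡ next j ⊎ j ≡ next (next i)
                           ⊎ i ≡ next (next j) ⊎ j ≡ next (next (next i))
hexagon-distances = from-yes (all? λ i → all? λ j →
  (i ≟ j) ⊎-dec (j ≟ next i) ⊎-dec (i ≟ next j) ⊎-dec (j ≟ next (next i))
  ⊎-dec (i ≟ next (next j)) ⊎-dec (j ≟ next (next (next i))))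

maximalAt : Bool → Bool → Bool → Bool
maximalAt true  a b = not a ∧ not b
maximalAt false a b = a ∨ b

maximalAt-comm : ∀ m a b → maximalAt m a b ≡ maximalAt m b a
maximalAt-comm true  false false = refl
maximalAt-comm true  false true  = refl
maximalAt-comm true  true  false = refl
maximalAt-comm true  true  true  = refl
maximalAt-comm false a     b     = ∨-comm a b

MaximalPattern : (Fin 6 → Bool) → Set
MaximalPattern p = ∀ i → maximalAt (p i) (p (next i)) (p (prev i)) ≡ true

data Sign : Set where
  pos null neg : Sign

isPos isNeg : Sign → Bool
isPos pos = true
isPos _   = false
isNeg neg = true
isNeg _   = false

-- On a hexagon the solutions of g(i) = g(i+1) + g(i-1) are g(0)·s₀ + g(1)·s₁, sσ = hexSign σ.
hexSign : Fin 2 → Fin 6 → Sign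
hexSign 0F 0F = pos
hexSign 0F 1F = null
hexSign 0F 2F = neg
hexSign 0F 3F = neg
hexSign 0F 4F = null
hexSign 0F 5F = pos
hexSign 1F 0F = null
hexSign 1F 1F = pos
hexSign 1F 2F = pos
hexSign 1F 3F = null
hexSign 1F 4F = neg
hexSign 1F 5F = neg

Balanced : Fin 2 → (Fin 6 → Bool) → Set
Balanced σ p = count (λ i → p i ∧ isPos (hexSign σ i)) ≡ count (λ i → p i ∧ isNeg (hexSign σ i))

noUnbalancedMaximalSubset : ∀ σ → ¬ ∃ λ (u : Subset 6) → MaximalPattern (lookup u) × ¬ Balanced σ (lookup u)
noUnbalancedMaximalSubset = from-yes (all? λ σ → ¬? (anySubset? λ u →
  all? (λ i → maximalAt (lookup u i) (lookup u (next i)) (lookup u (prev i)) 𝔹.≟ true)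
  ×-dec ¬? (count (λ i → lookup u i ∧ isPos (hexSign σ i)) ℕ.≟ count (λ i → lookup u i ∧ isNeg (hexSign σ i)))))

maximalPattern⇒balanced : ∀ σ p → MaximalPattern p → Balanced σ p
maximalPattern⇒balanced σ p maximal =
  trans (count-cong λ i → cong (_∧ isPos (hexSign σ i)) (sym (v≗p i)))
        (trans balancedᵥ (count-cong λ i → cong (_∧ isNeg (hexSign σ i)) (v≗p i)))
  where
  v : Subset 6
  v = tabulate p
  v≗p : ∀ i → lookup v i ≡ p i
  v≗p = lookup∘tabulate p
  maximalᵥ : MaximalPattern (lookup v)
  maximalᵥ i rewrite v≗p i | v≗p (next i) | v≗p (prev i) = maximal i
  balancedᵥ : Balanced σ (lookup v)
  balancedᵥ = decidable-stable (_ ℕ.≟ _) λ unbalanced → noUnbalancedMaximalSubset σ (v , maximalᵥ , unbalanced)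

maximalAt-true : ∀ a b → maximalAt true a b ≡ true → a ≡ false × b ≡ false
maximalAt-true false false _ = refl , refl

maximalAt-false : ∀ a b → maximalAt false a b ≡ true → a ≡ true ⊎ b ≡ true
maximalAt-false true  b _ = inj₁ refl
maximalAt-false false b e = inj₂ e

maximalAt-≡ : ∀ {a a′ b b′ c c′} → a ≡ a′ → b ≡ b′ → c ≡ c′ →
              maximalAt a′ b′ c′ ≡ true → maximalAt a b c ≡ true
maximalAt-≡ refl refl refl m = m

_⊆_ : ∀ {n} → (Fin n → Bool) → (Fin n → Bool) → Set
S ⊆ T = ∀ x → S x ≡ true → T x ≡ true

insert-self : ∀ {n} (a : Fin n) S → insert a S a ≡ true
insert-self a S with a ≟ a
... | yes _   = refl
... | no a≢a = ⊥-elim (a≢a refl)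

insert-true : ∀ {n} {a x : Fin n} S → insert a S x ≡ true → x ≡ a ⊎ S x ≡ true
insert-true {a = a} {x} S e with x ≟ a
... | yes x≡a = inj₁ x≡a
... | no _    = inj₂ e

⊆-insert : ∀ {n} (a : Fin n) S → S ⊆ insert a S
⊆-insert a S x Sx with x ≟ a
... | yes _ = refl
... | no _  = Sx

module Greedy {n} (G : Graph n) where
  open Graph G

  Dominated : (Fin n → Bool) → Fin n → Set
  Dominated S x = S x ≡ true ⊎ ∃[ y ] S y ≡ true × adj x y ≡ true

  dominated? : ∀ S x → Dec (Dominated S x)
  dominated? S x = (S x 𝔹.≟ true) ⊎-dec any? (λ y → (S y 𝔹.≟ true) ×-dec (adj x y 𝔹.≟ true))

  dominated-⊆ : ∀ {S T} → S ⊆ T → ∀ {x} → Dominated S x → Dominated T x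
  dominated-⊆ S⊆T (inj₁ Sx)            = inj₁ (S⊆T _ Sx)
  dominated-⊆ S⊆T (inj₂ (y , Sy , xy)) = inj₂ (y , S⊆T y Sy , xy)

  independent-insert : ∀ {S x} → Independent G S → ¬ Dominated S x → Independent G (insert x S)
  independent-insert {S} {x} indep undominated a b a∈ b∈
    with insert-true S a∈ | insert-true S b∈
  ... | inj₁ refl | inj₁ refl = adj-irrefl a
  ... | inj₁ refl | inj₂ Sb   = 𝔹.¬-not (λ ab → undominated (inj₂ (b , Sb , ab)))
  ... | inj₂ Sa   | inj₁ refl = 𝔹.¬-not (λ ab → undominated (inj₂ (a , Sa , trans (adj-sym b a) ab)))
  ... | inj₂ Sa   | inj₂ Sb   = indep a b Sa Sb

  step : Fin n → (Fin n → Bool) → Fin n → Bool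
  step x S with dominated? S x
  ... | yes _ = S
  ... | no _  = insert x S

  step-⊆ : ∀ x S → S ⊆ step x S
  step-⊆ x S with dominated? S x
  ... | yes _ = λ _ Sy → Sy
  ... | no _  = ⊆-insert x S

  step-dominates : ∀ x S → Dominated (step x S) x
  step-dominates x S with dominated? S x
  ... | yes dom = dom
  ... | no _    = inj₁ (insert-self x S)

  step-independent : ∀ x S → Independent G S → Independent G (step x S)
  step-independent x S indep with dominated? S x
  ... | yes _     = indep
  ... | no undom = independent-insert indep undom

  greedy : List (Fin n) → (Fin n → Bool) → Fin n → Bool
  greedy []       S = S
  greedy (x ∷ xs) S = greedy xs (step x S)

  greedy-⊆ : ∀ xs S → S ⊆ greedy xs S
  greedy-⊆ []       S y Sy = Sy
  greedy-⊆ (x ∷ xs) S y Sy = greedy-⊆ xs (step x S) y (step-⊆ x S y Sy)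

  greedy-independent : ∀ xs S → Independent G S → Independent G (greedy xs S)
  greedy-independent []       S indep = indep
  greedy-independent (x ∷ xs) S indep = greedy-independent xs (step x S) (step-independent x S indep)

  greedy-dominates : ∀ xs S {x} → x ∈ xs → Dominated (greedy xs S) x
  greedy-dominates (x ∷ xs) S (here refl) = dominated-⊆ (greedy-⊆ xs (step x S)) (step-dominates x S)
  greedy-dominates (y ∷ xs) S (there x∈) = greedy-dominates xs (step y S) x∈

  extend-to-maximal : ∀ S → Independent G S → ∃[ M ] MaximalIndependent G M × S ⊆ M
  extend-to-maximal S indep = M , (greedy-independent (allFin n) S indep , maximal) , greedy-⊆ (allFin n) S
    where
    M : Fin n → Bool
    M = greedy (allFin n) S
    maximal : ∀ x → M x ≡ false → ¬ Independent G (insert x M)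
    maximal x Mx≡false indep′ with greedy-dominates (allFin n) S (∈-allFin x)
    ... | inj₁ Mx              = false≢true (trans (sym Mx≡false) Mx)
    ... | inj₂ (y , My , xy) = false≢true (trans (sym (indep′ x y (insert-self x M) (⊆-insert x M y My))) xy)

  pair : Fin n → Fin n → Fin n → Bool
  pair a b = insert a (insert b (λ _ → false))

  pair-member : ∀ {a b} z → pair a b z ≡ true → z ≡ a ⊎ z ≡ b
  pair-member {a} {b} z z∈ with insert-true (insert b (λ _ → false)) z∈
  ... | inj₁ z≡a = inj₁ z≡a
  ... | inj₂ z∈′ with insert-true (λ _ → false) z∈′
  ...   | inj₁ z≡b = inj₂ z≡b
  ...   | inj₂ ()

  pair-independent : ∀ {a b} → adj a b ≡ false → Independent G (pair a b)
  pair-independent ab u v u∈ v∈ with pair-member u u∈ | pair-member v v∈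
  ... | inj₁ refl | inj₁ refl = adj-irrefl u
  ... | inj₁ refl | inj₂ refl = ab
  ... | inj₂ refl | inj₁ refl = trans (adj-sym u v) ab
  ... | inj₂ refl | inj₂ refl = adj-irrefl u

record TwoRegularGirth6 {n} (G : Graph n) : Set where
  open Graph G
  field
    nbr₁ nbr₂   : Fin n → Fin n
    adj-nbr₁    : ∀ x → adj x (nbr₁ x) ≡ true
    adj-nbr₂    : ∀ x → adj x (nbr₂ x) ≡ true
    nbr₁≢nbr₂   : ∀ x → nbr₁ x ≢ nbr₂ x
    adj⇒nbr     : ∀ x y → adj x y ≡ true → y ≡ nbr₁ x ⊎ y ≡ nbr₂ x
    colour      : Fin n → Bool
    adj⇒colour  : ∀ x y → adj x y ≡ true → colour y ≡ not (colour x)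
    no-4-cycle  : ∀ a b c d → adj a b ≡ true → adj b c ≡ true → adj c d ≡ true → adj d a ≡ true
                  → a ≢ c → b ≢ d → ⊥

module Cycles {n} {G : Graph n} (T : TwoRegularGirth6 G) where
  open Graph G
  open TwoRegularGirth6 T
  open Greedy G using (Dominated; independent-insert; extend-to-maximal; pair; pair-independent)

  infix 4 _~_
  _~_ : Fin n → Fin n → Set
  x ~ y = adj x y ≡ true

  ~-sym : ∀ {x y} → x ~ y → y ~ x
  ~-sym {x} {y} xy = trans (adj-sym y x) xy

  ~⇒≢ : ∀ {x y} → x ~ y → x ≢ y
  ~⇒≢ {x} xy refl with trans (sym xy) (adj-irrefl x)
  ... | ()

  nbrs-unique : ∀ {x a b w} → x ~ a → x ~ b → a ≢ b → x ~ w → w ≡ a ⊎ w ≡ b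
  nbrs-unique {x} xa xb a≢b xw with adj⇒nbr x _ xa | adj⇒nbr x _ xb | adj⇒nbr x _ xw
  ... | inj₁ refl | inj₁ refl | _         = ⊥-elim (a≢b refl)
  ... | inj₂ refl | inj₂ refl | _         = ⊥-elim (a≢b refl)
  ... | inj₁ refl | inj₂ refl | inj₁ refl = inj₁ refl
  ... | inj₁ refl | inj₂ refl | inj₂ refl = inj₂ refl
  ... | inj₂ refl | inj₁ refl | inj₁ refl = inj₂ refl
  ... | inj₂ refl | inj₁ refl | inj₂ refl = inj₁ refl

  opaque
    other : Fin n → Fin n → Fin n
    other a y = if ⌊ nbr₁ y ≟ a ⌋ then nbr₂ y else nbr₁ y

    other-adj : ∀ a y → y ~ other a y
    other-adj a y with nbr₁ y ≟ a
    ... | yes _ = adj-nbr₂ y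
    ... | no _  = adj-nbr₁ y

    other-≢ : ∀ a y → other a y ≢ a
    other-≢ a y with nbr₁ y ≟ a
    ... | yes n₁≡a = λ n₂≡a → nbr₁≢nbr₂ y (trans n₁≡a (sym n₂≡a))
    ... | no n₁≢a  = n₁≢a

  other-unique : ∀ {a y z} → y ~ a → y ~ z → z ≢ a → z ≡ other a y
  other-unique {a} {y} ya yz z≢a with nbrs-unique ya (other-adj a y) (λ e → other-≢ a y (sym e)) yz
  ... | inj₁ z≡a = ⊥-elim (z≢a z≡a)
  ... | inj₂ z≡o = z≡o

  colour-≢ : ∀ {a b} → colour a ≡ not (colour b) → a ≢ b
  colour-≢ e refl = 𝔹.not-¬ refl e

  same-colour⇒¬adj : ∀ {a b} → colour a ≡ colour b → adj a b ≡ false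
  same-colour⇒¬adj {a} {b} e = 𝔹.¬-not λ ab → 𝔹.not-¬ (sym e) (adj⇒colour a b ab)

  MaximalAt : (Fin n → Bool) → Fin n → Set
  MaximalAt M y = maximalAt (M y) (M (nbr₁ y)) (M (nbr₂ y)) ≡ true

  LocallyMaximal : (Fin n → Bool) → Set
  LocallyMaximal M = ∀ y → MaximalAt M y

  maximalAt-nbrs : ∀ (M : Fin n → Bool) {y a b} → y ~ a → y ~ b → a ≢ b →
                   maximalAt (M y) (M (nbr₁ y)) (M (nbr₂ y)) ≡ maximalAt (M y) (M a) (M b)
  maximalAt-nbrs M {y} {a} {b} ya yb a≢b
    with nbrs-unique ya yb a≢b (adj-nbr₁ y) | nbrs-unique ya yb a≢b (adj-nbr₂ y)
  ... | inj₁ refl | inj₁ n₂≡a = ⊥-elim (nbr₁≢nbr₂ y (sym n₂≡a))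
  ... | inj₁ refl | inj₂ refl = refl
  ... | inj₂ refl | inj₁ refl = maximalAt-comm (M y) (M b) (M a)
  ... | inj₂ refl | inj₂ n₂≡b = ⊥-elim (nbr₁≢nbr₂ y (sym n₂≡b))

  maximalAt-via : ∀ (M : Fin n → Bool) {y a b} → y ~ a → y ~ b → a ≢ b →
                  maximalAt (M y) (M a) (M b) ≡ true → MaximalAt M y
  maximalAt-via M ya yb a≢b m = trans (maximalAt-nbrs M ya yb a≢b) m

  member⇒nbr-out : ∀ M → LocallyMaximal M → ∀ {x y} → M x ≡ true → x ~ y → M y ≡ false
  member⇒nbr-out M lm {x} Mx xy
    with maximalAt-true (M (nbr₁ x)) (M (nbr₂ x)) (maximalAt-≡ (sym Mx) refl refl (lm x)) | adj⇒nbr x _ xy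
  ... | out₁ , _ | inj₁ refl = out₁
  ... | _ , out₂ | inj₂ refl = out₂

  locallyMaximal⇒maximalIndependent : ∀ M → LocallyMaximal M → MaximalIndependent G M
  locallyMaximal⇒maximalIndependent M lm = independent , maximal
    where
    independent : Independent G M
    independent a b Ma Mb = 𝔹.¬-not λ ab → false≢true (trans (sym (member⇒nbr-out M lm Ma ab)) Mb)
    maximal : ∀ x → M x ≡ false → ¬ Independent G (insert x M)
    maximal x Mx indep with maximalAt-false (M (nbr₁ x)) (M (nbr₂ x)) (maximalAt-≡ (sym Mx) refl refl (lm x))
    ... | inj₁ M₁ = false≢true (trans (sym (indep x _ (insert-self x M) (⊆-insert x M _ M₁))) (adj-nbr₁ x))
    ... | inj₂ M₂ = false≢true (trans (sym (indep x _ (insert-self x M) (⊆-insert x M _ M₂))) (adj-nbr₂ x))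

  maximalIndependent⇒locallyMaximal : ∀ M → MaximalIndependent G M → LocallyMaximal M
  maximalIndependent⇒locallyMaximal M (indep , maximal) y with M y in My
  ... | true = maximalAt-≡ {a′ = true} refl (out (adj-nbr₁ y)) (out (adj-nbr₂ y)) refl
    where
    out : ∀ {z} → y ~ z → M z ≡ false
    out {z} yz = 𝔹.¬-not λ Mz → false≢true (trans (sym (indep y z My Mz)) yz)
  ... | false with M (nbr₁ y) in M₁ | M (nbr₂ y) in M₂
  ...   | true  | _     = refl
  ...   | false | true  = refl
  ...   | false | false = ⊥-elim (maximal y My (independent-insert indep undominated))
    where
    undominated : ¬ Dominated M y
    undominated (inj₁ My′) = false≢true (trans (sym My) My′)
    undominated (inj₂ (z , Mz , yz)) with adj⇒nbr y z yz
    ... | inj₁ refl = false≢true (trans (sym M₁) Mz)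
    ... | inj₂ refl = false≢true (trans (sym M₂) Mz)

  extend-pair : ∀ {a b} → adj a b ≡ false → ∃[ E ] LocallyMaximal E × E a ≡ true × E b ≡ true
  extend-pair {a} {b} ab =
    let E , E-mis , pair⊆E = extend-to-maximal (pair a b) (pair-independent ab)
    in E , maximalIndependent⇒locallyMaximal E E-mis , pair⊆E a (insert-self a (insert b (λ _ → false)))
         , pair⊆E b (⊆-insert a (insert b (λ _ → false)) b (insert-self b (λ _ → false)))

  record Hexagon : Set where
    field
      vertex           : Fin 6 → Fin n
      vertex-adj       : ∀ i → vertex i ~ vertex (next i)
      vertex-injective : ∀ {i j} → vertex i ≡ vertex j → i ≡ j

  open Hexagon

  OnHexagon : Fin n → Set
  OnHexagon y = ∃[ H ] ∃[ i ] y ≡ vertex H i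

  HexagonFree : Fin n → Set
  HexagonFree y = ¬ OnHexagon y

  closedWalk⇒hexagon : (u : Fin 6 → Fin n) → (∀ i → u i ~ u (next i)) → (∀ i → u (next (next i)) ≢ u i)
                       → Hexagon
  closedWalk⇒hexagon u u-adj u-turn = record { vertex = u ; vertex-adj = u-adj ; vertex-injective = injective }
    where
    colour-next : ∀ i → colour (u (next i)) ≡ not (colour (u i))
    colour-next i = adj⇒colour _ _ (u-adj i)
    injective : ∀ {i j} → u i ≡ u j → i ≡ j
    injective {i} {j} e with hexagon-distances i j
    ... | inj₁ i≡j                                = i≡j
    ... | inj₂ (inj₁ refl)                        = ⊥-elim (~⇒≢ (u-adj i) e)
    ... | inj₂ (inj₂ (inj₁ refl))                 = ⊥-elim (~⇒≢ (u-adj j) (sym e))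
    ... | inj₂ (inj₂ (inj₂ (inj₁ refl)))          = ⊥-elim (u-turn i (sym e))
    ... | inj₂ (inj₂ (inj₂ (inj₂ (inj₁ refl))))   = ⊥-elim (u-turn j e)
    ... | inj₂ (inj₂ (inj₂ (inj₂ (inj₂ refl))))   = ⊥-elim (colour-≢ three-steps (sym e))
      where
      three-steps : colour (u (next (next (next i)))) ≡ not (colour (u i))
      three-steps = trans (colour-next _) (cong not (trans (colour-next _)
                      (trans (cong not (colour-next i)) (𝔹.not-involutive _))))

  -- The vertex reached after k steps along the cycle through a, leaving a towards its neighbour b.
  walk : ℕ → Fin n → Fin n → Fin n
  walk zero    a b = a
  walk (suc k) a b = walk k b (other a b)

  walk-follows : ∀ (u : ℕ → Fin n) → (∀ j → u (suc (suc j)) ≡ other (u j) (u (suc j)))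
                 → ∀ k → walk k (u 0) (u 1) ≡ u k
  walk-follows u step zero    = refl
  walk-follows u step (suc k) rewrite sym (step 0) = walk-follows (λ j → u (suc j)) (λ j → step (suc j)) k

  walk-adj : ∀ k {a b} → a ~ b → walk k a b ~ walk (suc k) a b
  walk-adj zero    ab = ab
  walk-adj (suc k) {a} {b} ab = walk-adj k (other-adj a b)

  walk-nonbacktracking : ∀ k a b → walk (suc (suc k)) a b ≢ walk k a b
  walk-nonbacktracking zero    a b = other-≢ a b
  walk-nonbacktracking (suc k) a b = walk-nonbacktracking k b (other a b)

  module HexagonWalks (H : Hexagon) where
    v : Fin 6 → Fin n
    v = vertex H

    prev-adj : ∀ i → v (prev i) ~ v i
    prev-adj i = subst (λ j → v (prev i) ~ v j) (next-prev i) (vertex-adj H (prev i))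

    walk-next : ∀ i k → walk k (v i) (v (next i)) ≡ v (next^ k i)
    walk-next i = walk-follows (λ j → v (next^ j i)) λ j →
      other-unique (~-sym (vertex-adj H _)) (vertex-adj H _)
                   (λ e → next²≢id _ (vertex-injective H e))

    walk-prev : ∀ i k → walk k (v i) (v (prev i)) ≡ v (prev^ k i)
    walk-prev i = walk-follows (λ j → v (prev^ j i)) λ j →
      other-unique (prev-adj _) (~-sym (prev-adj _))
                   (λ e → prev²≢id _ (vertex-injective H e))

    nbrs : ∀ {i z} → v i ~ z → z ≡ v (next i) ⊎ z ≡ v (prev i)
    nbrs {i} = nbrs-unique (vertex-adj H i) (~-sym (prev-adj i)) (λ e → next≢prev i (vertex-injective H e))

    walk-closes : ∀ {i z} → v i ~ z → walk 6 (v i) z ≡ v i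
    walk-closes {i} vz with nbrs vz
    ... | inj₁ refl = trans (walk-next i 6) (cong v (next^6≡id i))
    ... | inj₂ refl = trans (walk-prev i 6) (cong v (prev^6≡id i))

    walk-stays : ∀ {i z} → v i ~ z → ∀ k → ∃[ a ] walk k (v i) z ≡ v a
    walk-stays {i} vz k with nbrs vz
    ... | inj₁ refl = next^ k i , walk-next i k
    ... | inj₂ refl = prev^ k i , walk-prev i k

    walk-reaches : ∀ {i z} → v i ~ z → ∀ a → ∃[ k ] walk (toℕ k) (v i) z ≡ v a
    walk-reaches {i} vz a with nbrs vz
    ... | inj₁ refl = let k , e = next^-reaches i a in k , trans (walk-next i (toℕ k)) (cong v e)
    ... | inj₂ refl = let k , e = prev^-reaches i a in k , trans (walk-prev i (toℕ k)) (cong v e)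

  closes⇒hexagon : ∀ y → walk 6 y (nbr₁ y) ≡ y → Hexagon
  closes⇒hexagon y closed = closedWalk⇒hexagon u u-adj u-turn
    where
    u : Fin 6 → Fin n
    u j = walk (toℕ j) y (nbr₁ y)
    step : ∀ k → walk k y (nbr₁ y) ~ walk (suc k) y (nbr₁ y)
    step k = walk-adj k (adj-nbr₁ y)
    back : ∀ k → walk (suc (suc k)) y (nbr₁ y) ≢ walk k y (nbr₁ y)
    back k = walk-nonbacktracking k y (nbr₁ y)
    u-adj : ∀ i → u i ~ u (next i)
    u-adj 0F = step 0
    u-adj 1F = step 1
    u-adj 2F = step 2
    u-adj 3F = step 3
    u-adj 4F = step 4
    u-adj 5F = subst (u 5F ~_) closed (step 5)
    u-turn : ∀ i → u (next (next i)) ≢ u i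
    u-turn 0F = back 0
    u-turn 1F = back 1
    u-turn 2F = back 2
    u-turn 3F = back 3
    u-turn 4F = λ e → back 4 (trans closed e)
    u-turn 5F = λ e → no-4-cycle (u 1F) (u 2F) (u 3F) (u 4F) (step 1) (step 2) (step 3)
                        (subst (u 4F ~_) (sym e) (step 4)) (λ e′ → back 1 (sym e′)) (λ e′ → back 2 (sym e′))

  onHexagon⇒closes : ∀ {y} → OnHexagon y → walk 6 y (nbr₁ y) ≡ y
  onHexagon⇒closes (H , i , refl) = HexagonWalks.walk-closes H {i} (adj-nbr₁ _)

  shared-vertex : ∀ H H′ {i i′} → vertex H i ≡ vertex H′ i′ → ∀ a → ∃[ a′ ] vertex H a ≡ vertex H′ a′
  shared-vertex H H′ {i} {i′} e a =
    let k , reach = HexagonWalks.walk-reaches H {i} (adj-nbr₁ (vertex H i)) a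
        a′ , stay = HexagonWalks.walk-stays H′ {i′} (adj-nbr₁ (vertex H′ i′)) (toℕ k)
    in a′ , trans (sym reach) (trans (cong (λ z → walk (toℕ k) z (nbr₁ z)) e) stay)

  -- A hexagon is represented by its vertex of least index.
  Leader : Fin n → Set
  Leader y = walk 6 y (nbr₁ y) ≡ y × (∀ (j : Fin 6) → toℕ y ≤ toℕ (walk (toℕ j) y (nbr₁ y)))

  leader? : ∀ y → Dec (Leader y)
  leader? y = (walk 6 y (nbr₁ y) ≟ y) ×-dec all? λ j → toℕ y ℕ.≤? toℕ (walk (toℕ j) y (nbr₁ y))

  isLeader : Fin n → Bool
  isLeader y = ⌊ leader? y ⌋

  isLeader⇒leader : ∀ {y} → isLeader y ≡ true → Leader y
  isLeader⇒leader e = toWitness (Equivalence.from 𝔹.T-≡ e)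

  leader⇒isLeader : ∀ {y} → Leader y → isLeader y ≡ true
  leader⇒isLeader l = Equivalence.to 𝔹.T-≡ (fromWitness l)

  record HexagonDecomposition (m : ℕ) : Set where
    field
      hexagon  : Fin m → Hexagon
      disjoint : ∀ {t t′ a a′} → vertex (hexagon t) a ≡ vertex (hexagon t′) a′ → t ≡ t′
      covers   : ∀ y → (∃[ t ] ∃[ a ] y ≡ vertex (hexagon t) a) ⊎ HexagonFree y

  hexagon-decomposition : ∃ HexagonDecomposition
  hexagon-decomposition = count isLeader , record
    { hexagon = hexagon ; disjoint = λ {t} {t′} {a} {a′} → disjoint t t′ a a′ ; covers = covers }
    where
    open Enumeration (enumerate isLeader)
    leader : ∀ t → Leader (elem t)
    leader t = isLeader⇒leader (elem-P t)
    hexagon : Fin (count isLeader) → Hexagon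
    hexagon t = closes⇒hexagon (elem t) (proj₁ (leader t))
    leader-≤ : ∀ t t′ a a′ → vertex (hexagon t) a ≡ vertex (hexagon t′) a′ → toℕ (elem t) ≤ toℕ (elem t′)
    leader-≤ t t′ a a′ e = let b , e′ = shared-vertex (hexagon t′) (hexagon t) {a′} {a} (sym e) 0F
                          in subst (λ z → toℕ (elem t) ≤ toℕ z) (sym e′) (proj₂ (leader t) b)
    disjoint : ∀ t t′ a a′ → vertex (hexagon t) a ≡ vertex (hexagon t′) a′ → t ≡ t′
    disjoint t t′ a a′ e = elem-injective (Fin.≤-antisym (leader-≤ t t′ a a′ e) (leader-≤ t′ t a′ a (sym e)))
    covers : ∀ y → (∃[ t ] ∃[ a ] y ≡ vertex (hexagon t) a) ⊎ HexagonFree y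
    covers y with walk 6 y (nbr₁ y) ≟ y
    ... | no unclosed = inj₂ λ on → unclosed (onHexagon⇒closes on)
    ... | yes closed  = inj₁ (t , shared-vertex H (hexagon t) {i} {0F} r≡elem 0F)
      where
      H : Hexagon
      H = closes⇒hexagon y closed
      i : Fin 6
      i = proj₁ (argmin (λ j → toℕ (vertex H j)))
      r : Fin n
      r = vertex H i
      r-leader : Leader r
      r-leader = HexagonWalks.walk-closes H {i} (adj-nbr₁ r) , λ j →
        let a , e = HexagonWalks.walk-stays H {i} (adj-nbr₁ r) (toℕ j)
        in subst (λ z → toℕ r ≤ toℕ z) (sym e) (proj₂ (argmin (λ j → toℕ (vertex H j))) a)
      t : Fin (count isLeader)
      t = proj₁ (elem-surjective r (leader⇒isLeader r-leader))
      r≡elem : vertex H i ≡ elem t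
      r≡elem = sym (proj₂ (elem-surjective r (leader⇒isLeader r-leader)))

  module Window {x y : Fin n} (x~y : x ~ y) where
    x₁ x₋₁ x₂ x₋₂ x₃ x₋₃ : Fin n
    x₁  = y
    x₋₁ = other y x
    x₂  = other x x₁
    x₋₂ = other x x₋₁
    x₃  = other x₁ x₂
    x₋₃ = other x₋₁ x₋₂

    x~x₋₁ : x ~ x₋₁
    x~x₋₁ = other-adj y x
    x₁~x₂ : x₁ ~ x₂
    x₁~x₂ = other-adj x x₁
    x₋₁~x₋₂ : x₋₁ ~ x₋₂
    x₋₁~x₋₂ = other-adj x x₋₁
    x₂~x₃ : x₂ ~ x₃
    x₂~x₃ = other-adj x₁ x₂
    x₋₂~x₋₃ : x₋₂ ~ x₋₃
    x₋₂~x₋₃ = other-adj x₋₁ x₋₂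

    x₁≢x : x₁ ≢ x
    x₁≢x e = ~⇒≢ x~y (sym e)
    x₋₁≢x : x₋₁ ≢ x
    x₋₁≢x e = ~⇒≢ x~x₋₁ (sym e)
    x₋₁≢x₁ : x₋₁ ≢ x₁
    x₋₁≢x₁ = other-≢ y x
    x₂≢x : x₂ ≢ x
    x₂≢x = other-≢ x x₁
    x₋₂≢x : x₋₂ ≢ x
    x₋₂≢x = other-≢ x x₋₁
    x₃≢x₁ : x₃ ≢ x₁
    x₃≢x₁ = other-≢ x₁ x₂
    x₋₃≢x₋₁ : x₋₃ ≢ x₋₁
    x₋₃≢x₋₁ = other-≢ x₋₁ x₋₂

    colour-x₂ : colour x₂ ≡ colour x
    colour-x₂ = trans (adj⇒colour _ _ x₁~x₂)
                      (trans (cong not (adj⇒colour _ _ x~y)) (𝔹.not-involutive _))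
    colour-x₋₂ : colour x₋₂ ≡ colour x
    colour-x₋₂ = trans (adj⇒colour _ _ x₋₁~x₋₂)
                       (trans (cong not (adj⇒colour _ _ x~x₋₁)) (𝔹.not-involutive _))

    x₂≢x₋₁ : x₂ ≢ x₋₁
    x₂≢x₋₁ = colour-≢ (trans colour-x₂ (sym (trans (cong not (adj⇒colour _ _ x~x₋₁)) (𝔹.not-involutive _))))
    x₋₂≢x₁ : x₋₂ ≢ x₁
    x₋₂≢x₁ = colour-≢ (trans colour-x₋₂ (sym (trans (cong not (adj⇒colour _ _ x~y)) (𝔹.not-involutive _))))
    x₃≢x : x₃ ≢ x
    x₃≢x = colour-≢ (trans (adj⇒colour _ _ x₂~x₃) (cong not colour-x₂))
    x₋₃≢x : x₋₃ ≢ x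
    x₋₃≢x = colour-≢ (trans (adj⇒colour _ _ x₋₂~x₋₃) (cong not colour-x₋₂))

    x₃≢x₋₁ : x₃ ≢ x₋₁
    x₃≢x₋₁ e = no-4-cycle x x₁ x₂ x₋₁ x~y x₁~x₂ (subst (x₂ ~_) e x₂~x₃) (~-sym x~x₋₁)
                          (λ e → x₂≢x (sym e)) (λ e → x₋₁≢x₁ (sym e))
    x₋₃≢x₁ : x₋₃ ≢ x₁
    x₋₃≢x₁ e = no-4-cycle x x₋₁ x₋₂ x₁ x~x₋₁ x₋₁~x₋₂ (subst (x₋₂ ~_) e x₋₂~x₋₃) (~-sym x~y)
                          (λ e → x₋₂≢x (sym e)) x₋₁≢x₁
    x₋₂≢x₂ : x₋₂ ≢ x₂
    x₋₂≢x₂ e = no-4-cycle x x₁ x₂ x₋₁ x~y x₁~x₂ (subst (_~ x₋₁) e (~-sym x₋₁~x₋₂)) (~-sym x~x₋₁)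
                          (λ e → x₂≢x (sym e)) (λ e → x₋₁≢x₁ (sym e))

    x₃≁x₋₃ : adj x₃ x₋₃ ≡ false
    x₃≁x₋₃ = same-colour⇒¬adj (trans (adj⇒colour _ _ x₂~x₃)
               (trans (cong not (trans colour-x₂ (sym colour-x₋₂))) (sym (adj⇒colour _ _ x₋₂~x₋₃))))

    hexagonFree⇒x₋₂≁x₃ : HexagonFree x → adj x₋₂ x₃ ≡ false
    hexagonFree⇒x₋₂≁x₃ free =
      𝔹.¬-not λ x₋₂~x₃ → free (closedWalk⇒hexagon u (u-adj x₋₂~x₃) u-turn , 0F , refl)
      where
      u : Fin 6 → Fin n
      u 0F = x
      u 1F = x₁
      u 2F = x₂
      u 3F = x₃
      u 4F = x₋₂
      u 5F = x₋₁
      u-adj : x₋₂ ~ x₃ → ∀ i → u i ~ u (next i)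
      u-adj _       0F = x~y
      u-adj _       1F = x₁~x₂
      u-adj _       2F = x₂~x₃
      u-adj x₋₂~x₃ 3F = ~-sym x₋₂~x₃
      u-adj _       4F = ~-sym x₋₁~x₋₂
      u-adj _       5F = ~-sym x~x₋₁
      u-turn : ∀ i → u (next (next i)) ≢ u i
      u-turn 0F = x₂≢x
      u-turn 1F = x₃≢x₁
      u-turn 2F = x₋₂≢x₂
      u-turn 3F = λ e → x₃≢x₋₁ (sym e)
      u-turn 4F = λ e → x₋₂≢x (sym e)
      u-turn 5F = λ e → x₋₁≢x₁ (sym e)

    Outside : Fin n → Set
    Outside z = z ≢ x × z ≢ x₁ × z ≢ x₋₁

    outside-x₂ : Outside x₂
    outside-x₂ = x₂≢x , (λ e → ~⇒≢ x₁~x₂ (sym e)) , x₂≢x₋₁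
    outside-x₋₂ : Outside x₋₂
    outside-x₋₂ = x₋₂≢x , x₋₂≢x₁ , (λ e → ~⇒≢ x₋₁~x₋₂ (sym e))
    outside-x₃ : Outside x₃
    outside-x₃ = x₃≢x , x₃≢x₁ , x₃≢x₋₁
    outside-x₋₃ : Outside x₋₃
    outside-x₋₃ = x₋₃≢x , x₋₃≢x₁ , x₋₃≢x₋₁

    outside-nbr : ∀ {z w} → Outside z → z ≢ x₂ → z ≢ x₋₂ → z ~ w → Outside w
    outside-nbr {z} (z≢x , z≢x₁ , z≢x₋₁) z≢x₂ z≢x₋₂ zw = w≢x , w≢x₁ , w≢x₋₁
      where
      w≢x : _
      w≢x refl with nbrs-unique x~y x~x₋₁ (λ e → x₋₁≢x₁ (sym e)) (~-sym zw)
      ... | inj₁ e = z≢x₁ e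
      ... | inj₂ e = z≢x₋₁ e
      w≢x₁ : _
      w≢x₁ refl with nbrs-unique (~-sym x~y) x₁~x₂ (λ e → x₂≢x (sym e)) (~-sym zw)
      ... | inj₁ e = z≢x e
      ... | inj₂ e = z≢x₂ e
      w≢x₋₁ : _
      w≢x₋₁ refl with nbrs-unique (~-sym x~x₋₁) x₋₁~x₋₂ (λ e → x₋₂≢x (sym e)) (~-sym zw)
      ... | inj₁ e = z≢x e
      ... | inj₂ e = z≢x₋₂ e

    position : ∀ z → z ≡ x ⊎ z ≡ x₁ ⊎ z ≡ x₋₁ ⊎ Outside z
    position z with z ≟ x | z ≟ x₁ | z ≟ x₋₁
    ... | yes e | _     | _     = inj₁ e
    ... | no _  | yes e | _     = inj₂ (inj₁ e)
    ... | no _  | no _  | yes e = inj₂ (inj₂ (inj₁ e))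
    ... | no a  | no b  | no c  = inj₂ (inj₂ (inj₂ (a , b , c)))

    locate : ∀ z → z ≡ x ⊎ z ≡ x₁ ⊎ z ≡ x₋₁ ⊎ z ≡ x₂ ⊎ z ≡ x₋₂
                 ⊎ Outside z × z ≢ x₂ × z ≢ x₋₂
    locate z with position z | z ≟ x₂ | z ≟ x₋₂
    ... | inj₁ e                   | _     | _     = inj₁ e
    ... | inj₂ (inj₁ e)            | _     | _     = inj₂ (inj₁ e)
    ... | inj₂ (inj₂ (inj₁ e))     | _     | _     = inj₂ (inj₂ (inj₁ e))
    ... | inj₂ (inj₂ (inj₂ _))     | yes e | _     = inj₂ (inj₂ (inj₂ (inj₁ e)))
    ... | inj₂ (inj₂ (inj₂ _))     | no _  | yes e = inj₂ (inj₂ (inj₂ (inj₂ (inj₁ e))))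
    ... | inj₂ (inj₂ (inj₂ out))   | no a  | no b  = inj₂ (inj₂ (inj₂ (inj₂ (inj₂ (out , a , b)))))

    module Reset (E : Fin n → Bool) where
      reset : Bool → Bool → Bool → Fin n → Bool
      reset b₀ b₁ b₋₁ z =
        if ⌊ z ≟ x ⌋ then b₀ else if ⌊ z ≟ x₁ ⌋ then b₁ else if ⌊ z ≟ x₋₁ ⌋ then b₋₁ else E z

      module _ {b₀ b₁ b₋₁ : Bool} where
        reset-x : reset b₀ b₁ b₋₁ x ≡ b₀
        reset-x with x ≟ x
        ... | yes _   = refl
        ... | no x≢x = ⊥-elim (x≢x refl)

        reset-x₁ : reset b₀ b₁ b₋₁ x₁ ≡ b₁
        reset-x₁ with x₁ ≟ x | x₁ ≟ x₁
        ... | yes x₁≡x | _         = ⊥-elim (~⇒≢ x~y (sym x₁≡x))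
        ... | no _     | yes _     = refl
        ... | no _     | no x₁≢x₁ = ⊥-elim (x₁≢x₁ refl)

        reset-x₋₁ : reset b₀ b₁ b₋₁ x₋₁ ≡ b₋₁
        reset-x₋₁ with x₋₁ ≟ x | x₋₁ ≟ x₁ | x₋₁ ≟ x₋₁
        ... | yes x₋₁≡x | _          | _            = ⊥-elim (~⇒≢ x~x₋₁ (sym x₋₁≡x))
        ... | no _      | yes x₋₁≡x₁ | _            = ⊥-elim (x₋₁≢x₁ x₋₁≡x₁)
        ... | no _      | no _       | yes _        = refl
        ... | no _      | no _       | no x₋₁≢x₋₁ = ⊥-elim (x₋₁≢x₋₁ refl)

        reset-outside : ∀ {z} → Outside z → reset b₀ b₁ b₋₁ z ≡ E z
        reset-outside {z} (z≢x , z≢x₁ , z≢x₋₁) with z ≟ x | z ≟ x₁ | z ≟ x₋₁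
        ... | yes z≡x | _        | _         = ⊥-elim (z≢x z≡x)
        ... | no _    | yes z≡x₁ | _         = ⊥-elim (z≢x₁ z≡x₁)
        ... | no _    | no _     | yes z≡x₋₁ = ⊥-elim (z≢x₋₁ z≡x₋₁)
        ... | no _    | no _     | no _      = refl

        reset-maximal : LocallyMaximal E → ∀ {e₂ e₋₂ e₃ e₋₃} →
          E x₂ ≡ e₂ → E x₋₂ ≡ e₋₂ → E x₃ ≡ e₃ → E x₋₃ ≡ e₋₃ →
          maximalAt b₀ b₁ b₋₁ ≡ true → maximalAt b₁ b₀ e₂ ≡ true → maximalAt b₋₁ b₀ e₋₂ ≡ true →
          maximalAt e₂ b₁ e₃ ≡ true → maximalAt e₋₂ b₋₁ e₋₃ ≡ true → LocallyMaximal (reset b₀ b₁ b₋₁)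
        reset-maximal E-maximal E₂ E₋₂ E₃ E₋₃ m₀ m₁ m₋₁ m₂ m₋₂ z
          with locate z
        ... | inj₁ refl =
          maximalAt-via (reset b₀ b₁ b₋₁) x~y x~x₋₁ (λ e → x₋₁≢x₁ (sym e))
            (maximalAt-≡ reset-x reset-x₁ reset-x₋₁ m₀)
        ... | inj₂ (inj₁ refl) =
          maximalAt-via (reset b₀ b₁ b₋₁) (~-sym x~y) x₁~x₂ (λ e → x₂≢x (sym e))
            (maximalAt-≡ reset-x₁ reset-x (trans (reset-outside outside-x₂) E₂) m₁)
        ... | inj₂ (inj₂ (inj₁ refl)) =
          maximalAt-via (reset b₀ b₁ b₋₁) (~-sym x~x₋₁) x₋₁~x₋₂ (λ e → x₋₂≢x (sym e))
            (maximalAt-≡ reset-x₋₁ reset-x (trans (reset-outside outside-x₋₂) E₋₂) m₋₁)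
        ... | inj₂ (inj₂ (inj₂ (inj₁ refl))) =
          maximalAt-via (reset b₀ b₁ b₋₁) (~-sym x₁~x₂) x₂~x₃ (λ e → x₃≢x₁ (sym e))
            (maximalAt-≡ (trans (reset-outside outside-x₂) E₂) reset-x₁
                         (trans (reset-outside outside-x₃) E₃) m₂)
        ... | inj₂ (inj₂ (inj₂ (inj₂ (inj₁ refl)))) =
          maximalAt-via (reset b₀ b₁ b₋₁) (~-sym x₋₁~x₋₂) x₋₂~x₋₃ (λ e → x₋₃≢x₋₁ (sym e))
            (maximalAt-≡ (trans (reset-outside outside-x₋₂) E₋₂) reset-x₋₁
                         (trans (reset-outside outside-x₋₃) E₋₃) m₋₂)
        ... | inj₂ (inj₂ (inj₂ (inj₂ (inj₂ (z-out , z≢x₂ , z≢x₋₂))))) =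
          maximalAt-≡ (reset-outside z-out) (reset-outside (outside-nbr z-out z≢x₂ z≢x₋₂ (adj-nbr₁ z)))
                      (reset-outside (outside-nbr z-out z≢x₂ z≢x₋₂ (adj-nbr₂ z))) (E-maximal z)

record ComponentEmbedding {a N} (G : Graph a) (H : Graph N) : Set where
  field
    embed           : Fin a → Fin N
    embed-injective : ∀ {x y} → embed x ≡ embed y → x ≡ y
    embed-adj       : ∀ x y → Graph.adj H (embed x) (embed y) ≡ Graph.adj G x y
    embed-closed    : ∀ x z → Graph.adj H (embed x) z ≡ true → ∃[ x′ ] embed x′ ≡ z

module ComponentHexagons {a N} {G : Graph a} {H : Graph N} (TG : TwoRegularGirth6 G) (TH : TwoRegularGirth6 H)
                         (E : ComponentEmbedding G H) where
  open ComponentEmbedding E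
  module CG = Cycles TG
  module CH = Cycles TH
  open CG.Hexagon
  open CH.Hexagon renaming (vertex to vertexᴴ; vertex-adj to vertex-adjᴴ; vertex-injective to vertex-injectiveᴴ)

  push : CG.Hexagon → CH.Hexagon
  push K = record
    { vertex           = λ i → embed (vertex K i)
    ; vertex-adj       = λ i → trans (embed-adj _ _) (vertex-adj K i)
    ; vertex-injective = λ e → vertex-injective K (embed-injective e)
    }

  push-free : ∀ {x} → CG.HexagonFree x → CH.HexagonFree (embed x)
  push-free {x} free (K , i , x≡) = free (pulled , i , embed-injective (trans x≡ (sym (proj₂ (preimage i)))))
    where
    along : ∀ k → ∃[ x′ ] embed x′ ≡ vertexᴴ K (next^ k i)
    along zero    = x , x≡
    along (suc k) = let x′ , e = along k
                    in embed-closed x′ _ (subst (λ z → Graph.adj H z _ ≡ true) (sym e) (vertex-adjᴴ K (next^ k i)))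
    preimage : ∀ j → ∃[ x′ ] embed x′ ≡ vertexᴴ K j
    preimage j = let k , e = next^-reaches i j in subst (λ j′ → ∃[ x′ ] embed x′ ≡ vertexᴴ K j′) e (along (toℕ k))
    pulled : CG.Hexagon
    pulled = record
      { vertex           = λ j → proj₁ (preimage j)
      ; vertex-adj       = λ j → trans (sym (embed-adj _ _))
          (subst₂ (λ u w → Graph.adj H u w ≡ true) (sym (proj₂ (preimage j))) (sym (proj₂ (preimage (next j))))
                  (vertex-adjᴴ K j))
      ; vertex-injective = λ {j} {j′} e → vertex-injectiveᴴ K
          (trans (sym (proj₂ (preimage j))) (trans (cong embed e) (proj₂ (preimage j′))))
      }

module HexagonUnion {a b N} {GL : Graph a} {GR : Graph b} {H : Graph N}
                    (TL : TwoRegularGirth6 GL) (TR : TwoRegularGirth6 GR) (TH : TwoRegularGirth6 H)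
                    (L : ComponentEmbedding GL H) (R : ComponentEmbedding GR H)
                    (apart : ∀ x y → ComponentEmbedding.embed L x ≢ ComponentEmbedding.embed R y)
                    (exhaustive : ∀ z → (∃[ x ] ComponentEmbedding.embed L x ≡ z)
                                      ⊎ (∃[ y ] ComponentEmbedding.embed R y ≡ z))
                    where
  module CL = Cycles TL
  module CR = Cycles TR
  module CH = Cycles TH
  module HL = ComponentHexagons TL TH L
  module HR = ComponentHexagons TR TH R
  open ComponentEmbedding L using () renaming (embed to embedL; embed-injective to embedL-injective)
  open ComponentEmbedding R using () renaming (embed to embedR; embed-injective to embedR-injective)
  open CH.Hexagon using (vertex)

  union : ∀ {m k} → CL.HexagonDecomposition m → CR.HexagonDecomposition k → CH.HexagonDecomposition (m ℕ.+ k)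
  union {m} {k} DL DR = record
    { hexagon = λ i → hexagon⊎ (splitAt m i)
    ; disjoint = λ {i} {i′} {a} {a′} e → splitAt-injective m (disjoint⊎ (splitAt m i) (splitAt m i′) a a′ e)
    ; covers = covers
    }
    where
    module DL = CL.HexagonDecomposition DL
    module DR = CR.HexagonDecomposition DR
    hexagon⊎ : Fin m ⊎ Fin k → CH.Hexagon
    hexagon⊎ (inj₁ t) = HL.push (DL.hexagon t)
    hexagon⊎ (inj₂ t) = HR.push (DR.hexagon t)
    disjoint⊎ : ∀ s s′ a a′ → vertex (hexagon⊎ s) a ≡ vertex (hexagon⊎ s′) a′ → s ≡ s′
    disjoint⊎ (inj₁ t) (inj₁ t′) a a′ e = cong inj₁ (DL.disjoint (embedL-injective e))
    disjoint⊎ (inj₂ t) (inj₂ t′) a a′ e = cong inj₂ (DR.disjoint (embedR-injective e))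
    disjoint⊎ (inj₁ t) (inj₂ t′) a a′ e = ⊥-elim (apart _ _ e)
    disjoint⊎ (inj₂ t) (inj₁ t′) a a′ e = ⊥-elim (apart _ _ (sym e))
    vertex-↑ˡ : ∀ t a → vertex (hexagon⊎ (splitAt m (t ↑ˡ k))) a ≡ embedL (CL.Hexagon.vertex (DL.hexagon t) a)
    vertex-↑ˡ t a = cong (λ s → vertex (hexagon⊎ s) a) (Fin.splitAt-↑ˡ m t k)
    vertex-↑ʳ : ∀ t a → vertex (hexagon⊎ (splitAt m (m ↑ʳ t))) a ≡ embedR (CR.Hexagon.vertex (DR.hexagon t) a)
    vertex-↑ʳ t a = cong (λ s → vertex (hexagon⊎ s) a) (Fin.splitAt-↑ʳ m k t)
    covers : ∀ z → (∃[ i ] ∃[ a ] z ≡ vertex (hexagon⊎ (splitAt m i)) a) ⊎ CH.HexagonFree z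
    covers z with exhaustive z
    ... | inj₁ (x , refl) with DL.covers x
    ...   | inj₁ (t , a , refl) = inj₁ (t ↑ˡ k , a , sym (vertex-↑ˡ t a))
    ...   | inj₂ free           = inj₂ (HL.push-free free)
    covers z | inj₂ (y , refl) with DR.covers y
    ...   | inj₁ (t , a , refl) = inj₁ (m ↑ʳ t , a , sym (vertex-↑ʳ t a))
    ...   | inj₂ free           = inj₂ (HR.push-free free)

module Weightings {c ℓ} (F : Field c ℓ) where
  open Field F using (Carrier; _≈_; _+_; _*_; -_; 0#; 1#; +-cong; +-congˡ; +-congʳ; +-assoc; +-comm;
                     +-identityˡ; +-identityʳ; -‿inverseˡ; -‿cong; *-congˡ; *-identityʳ; zeroʳ;
                     +-commutativeMonoid; +-abelianGroup; +-rawMonoid; ring)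
  open Field F using () renaming (refl to ≈-refl; sym to ≈-sym; trans to ≈-trans; reflexive to ≈-reflexive)
  open import Algebra.Properties.CommutativeMonoid.Sum +-commutativeMonoid
    using (sum; sum-cong-≋; sum-remove; sum-replicate-zero; ∑-distrib-+; ∑-comm)
  open import Algebra.Properties.AbelianGroup +-abelianGroup
    using (identityˡ-unique; ∙-cancelʳ; y≈x\\z)
  open import Algebra.Properties.Ring ring using (-‿distribʳ-*; x+x≈x⇒x≈0)
  open import Algebra.Definitions.RawMonoid +-rawMonoid using () renaming (_×_ to _·_)
  open import Relation.Binary.Reasoning.Setoid (Field.setoid F)

  Σᶠ≡sum : ∀ {k} (g : Fin k → Carrier) → Σᶠ F g ≡ sum g
  Σᶠ≡sum {zero}  g = refl
  Σᶠ≡sum {suc k} g = cong (g zero +_) (Σᶠ≡sum (λ i → g (suc i)))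

  sum-zero : ∀ {k} (g : Fin k → Carrier) → (∀ i → g i ≈ 0#) → sum g ≈ 0#
  sum-zero {k} g g≈0 = ≈-trans (sum-cong-≋ g≈0) (sum-replicate-zero k)

  sum-single : ∀ {k} (g : Fin k → Carrier) a → (∀ i → i ≢ a → g i ≈ 0#) → sum g ≈ g a
  sum-single {suc k} g a zero-elsewhere = begin
    sum g                       ≈⟨ sum-remove {i = a} g ⟩
    g a + sum (removeAt g a)    ≈⟨ +-congˡ (sum-zero (removeAt g a) rest≈0) ⟩
    g a + 0#                    ≈⟨ +-identityʳ (g a) ⟩
    g a                         ∎
    where
    rest≈0 : ∀ j → removeAt g a j ≈ 0#
    rest≈0 j = zero-elsewhere (punchIn a j) (Fin.punchInᵢ≢i a j)

  sum-pair : ∀ {k} (g : Fin k → Carrier) {a b} → a ≢ b → (∀ i → i ≢ a → i ≢ b → g i ≈ 0#) → sum g ≈ g a + g b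
  sum-pair {suc k} g {a} {b} a≢b zero-elsewhere = begin
    sum g                                 ≈⟨ sum-remove {i = a} g ⟩
    g a + sum (removeAt g a)              ≈⟨ +-congˡ (sum-single (removeAt g a) b′ rest≈0) ⟩
    g a + g (punchIn a b′)                ≡⟨ cong (λ i → g a + g i) (Fin.punchIn-punchOut a≢b) ⟩
    g a + g b                             ∎
    where
    b′ : Fin k
    b′ = punchOut a≢b
    rest≈0 : ∀ j → j ≢ b′ → removeAt g a j ≈ 0#
    rest≈0 j j≢b′ = zero-elsewhere (punchIn a j) (Fin.punchInᵢ≢i a j)
      (λ e → j≢b′ (Fin.punchIn-injective a j b′ (trans e (sym (Fin.punchIn-punchOut a≢b)))))

  value : Sign → Carrier
  value pos  = 1#
  value null = 0#
  value neg  = - 1#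

  signed : Sign → Carrier → Carrier
  signed pos  x = x
  signed null x = 0#
  signed neg  x = - x

  *-value : ∀ x σ → x * value σ ≈ signed σ x
  *-value x pos  = *-identityʳ x
  *-value x null = zeroʳ x
  *-value x neg  = ≈-trans (≈-sym (-‿distribʳ-* x 1#)) (-‿cong (*-identityʳ x))

  -a+[-b+a]≈-b : ∀ a b → - a + (- b + a) ≈ - b
  -a+[-b+a]≈-b a b = begin
    - a + (- b + a)   ≈⟨ +-congˡ (+-comm (- b) a) ⟩
    - a + (a + - b)   ≈⟨ ≈-sym (+-assoc (- a) a (- b)) ⟩
    (- a + a) + - b   ≈⟨ +-congʳ (-‿inverseˡ a) ⟩
    0# + - b          ≈⟨ +-identityˡ (- b) ⟩
    - b               ∎

  hexagon-recurrence-solution : (g : Fin 6 → Carrier) → (∀ i → g i ≈ g (next i) + g (prev i)) →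
    ∀ a → g 0F * value (hexSign 0F a) + g 1F * value (hexSign 1F a) ≈ g a
  hexagon-recurrence-solution g rec a = ≈-trans (+-cong (*-value (g 0F) (hexSign 0F a)) (*-value (g 1F) (hexSign 1F a))) (solution a)
    where
    solve-for : ∀ {x y z} → z ≈ y + x → y ≈ - x + z
    solve-for {x} {y} {z} z≈y+x = y≈x\\z x y z (≈-trans (+-comm x y) (≈-sym z≈y+x))
    g₂ : g 2F ≈ - g 0F + g 1F
    g₂ = solve-for (rec 1F)
    g₅ : g 5F ≈ - g 1F + g 0F
    g₅ = solve-for (≈-trans (rec 0F) (+-comm (g 1F) (g 5F)))
    solution : ∀ a → signed (hexSign 0F a) (g 0F) + signed (hexSign 1F a) (g 1F) ≈ g a
    solution 0F = +-identityʳ (g 0F)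
    solution 1F = +-identityˡ (g 1F)
    solution 2F = ≈-sym g₂
    solution 3F = ≈-trans (+-identityʳ _) (≈-sym (≈-trans (solve-for (rec 2F))
                          (≈-trans (+-congˡ g₂) (-a+[-b+a]≈-b (g 1F) (g 0F)))))
    solution 4F = ≈-trans (+-identityˡ _) (≈-sym (≈-trans (solve-for (≈-trans (rec 5F) (+-comm (g 0F) (g 4F))))
                          (≈-trans (+-congˡ g₅) (-a+[-b+a]≈-b (g 0F) (g 1F)))))
    solution 5F = ≈-trans (+-comm (g 0F) (- g 1F)) (≈-sym g₅)

  [-a+b]+[a+c]≈b+c : ∀ a b c → (- a + b) + (a + c) ≈ b + c
  [-a+b]+[a+c]≈b+c a b c = begin
    (- a + b) + (a + c)   ≈⟨ +-congʳ (+-comm (- a) b) ⟩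
    (b + - a) + (a + c)   ≈⟨ +-assoc b (- a) (a + c) ⟩
    b + (- a + (a + c))   ≈⟨ +-congˡ (≈-sym (+-assoc (- a) a c)) ⟩
    b + ((- a + a) + c)   ≈⟨ +-congˡ (+-congʳ (-‿inverseˡ a)) ⟩
    b + (0# + c)          ≈⟨ +-congˡ (+-identityˡ c) ⟩
    b + c                 ∎

  signed-sum : ∀ {k} (p : Fin k → Bool) (s : Fin k → Sign) →
    sum (λ j → if p j then value (s j) else 0#) + count (λ j → p j ∧ isNeg (s j)) · 1#
    ≈ count (λ j → p j ∧ isPos (s j)) · 1#
  signed-sum {zero} p s = +-identityˡ 0#
  signed-sum {suc k} p s with p zero | s zero | signed-sum (λ j → p (suc j)) (λ j → s (suc j))
  ... | false | _    | ih = ≈-trans (+-congʳ (+-identityˡ _)) ih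
  ... | true  | null | ih = ≈-trans (+-congʳ (+-identityˡ _)) ih
  ... | true  | pos  | ih = ≈-trans (+-assoc 1# _ _) (+-congˡ ih)
  ... | true  | neg  | ih = ≈-trans ([-a+b]+[a+c]≈b+c 1# _ _) ih

  balanced⇒signed-sum≈0 : ∀ σ p → Balanced σ p → sum (λ j → if p j then value (hexSign σ j) else 0#) ≈ 0#
  balanced⇒signed-sum≈0 σ p balanced = identityˡ-unique _ _
    (≈-trans (signed-sum p (hexSign σ)) (≈-reflexive (cong (_· 1#) balanced)))

  when : Bool → Carrier → Carrier
  when b v = if b then v else 0#

  δ : ∀ {k} → Fin k → Carrier → Fin k → Carrier
  δ a v z = when ⌊ z ≟ a ⌋ v

  δ-self : ∀ {k} (a : Fin k) v → δ a v a ≡ v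
  δ-self a v with a ≟ a
  ... | yes _   = refl
  ... | no a≢a = ⊥-elim (a≢a refl)

  δ-≢ : ∀ {k} {a z : Fin k} v → z ≢ a → δ a v z ≡ 0#
  δ-≢ {a = a} {z} v z≢a with z ≟ a
  ... | yes z≡a = ⊥-elim (z≢a z≡a)
  ... | no _    = refl

  sum-δ : ∀ {k} (a : Fin k) v → sum (δ a v) ≈ v
  sum-δ a v = ≈-trans (sum-single (δ a v) a (λ z z≢a → ≈-reflexive (δ-≢ v z≢a))) (≈-reflexive (δ-self a v))

  sum-δ³ : ∀ {k} (a b c : Fin k) u v w (g : Fin k → Carrier) →
           sum (λ z → ((δ a u z + δ b v z) + δ c w z) + g z) ≈ ((u + v) + w) + sum g
  sum-δ³ a b c u v w g = begin
    sum (λ z → ((δ a u z + δ b v z) + δ c w z) + g z)       ≈⟨ ∑-distrib-+ _ g ⟩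
    sum (λ z → (δ a u z + δ b v z) + δ c w z) + sum g       ≈⟨ +-congʳ (∑-distrib-+ _ (δ c w)) ⟩
    (sum (λ z → δ a u z + δ b v z) + sum (δ c w)) + sum g
      ≈⟨ +-congʳ (+-cong (∑-distrib-+ (δ a u) (δ b v)) (sum-δ c w)) ⟩
    ((sum (δ a u) + sum (δ b v)) + w) + sum g
      ≈⟨ +-congʳ (+-congʳ (+-cong (sum-δ a u) (sum-δ b v))) ⟩
    ((u + v) + w) + sum g                                   ∎

  module OnCycles {n} {G : Graph n} (T : TwoRegularGirth6 G) where
    open Graph G using (adj)
    open TwoRegularGirth6 T
    open Cycles T

    module WindowWeights {x y : Fin n} (x~y : x ~ y) (E : Fin n → Bool) (f : Fin n → Carrier) where
      open Window x~y
      open Reset E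

      at : ∀ (M : Fin n → Bool) {z b} → M z ≡ b → when (M z) (f z) ≡ when b (f z)
      at M = cong (λ b → when b _)

      module _ (b₀ b₁ b₋₁ : Bool) where
        w₀ w₁ w₋₁ : Carrier
        w₀  = when b₀ (f x)
        w₁  = when b₁ (f x₁)
        w₋₁ = when b₋₁ (f x₋₁)

        when-reset : ∀ z → when (reset b₀ b₁ b₋₁ z) (f z)
                     ≈ ((δ x w₀ z + δ x₁ w₁ z) + δ x₋₁ w₋₁ z) + when (reset false false false z) (f z)
        when-reset z with position z
        ... | inj₁ refl = ≈-sym (begin
          ((δ x w₀ x + δ x₁ w₁ x) + δ x₋₁ w₋₁ x) + when (reset false false false x) (f x)
            ≡⟨ cong₂ _+_ (cong₂ _+_ (cong₂ _+_ (δ-self x w₀) (δ-≢ w₁ (~⇒≢ x~y))) (δ-≢ w₋₁ (~⇒≢ x~x₋₁)))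
                         (at (reset false false false) reset-x) ⟩
          ((w₀ + 0#) + 0#) + 0#  ≈⟨ ≈-trans (+-identityʳ _) (≈-trans (+-identityʳ _) (+-identityʳ _)) ⟩
          w₀                     ≡⟨ sym (at (reset b₀ b₁ b₋₁) reset-x) ⟩
          when (reset b₀ b₁ b₋₁ x) (f x) ∎)
        ... | inj₂ (inj₁ refl) = ≈-sym (begin
          ((δ x w₀ x₁ + δ x₁ w₁ x₁) + δ x₋₁ w₋₁ x₁) + when (reset false false false x₁) (f x₁)
            ≡⟨ cong₂ _+_ (cong₂ _+_ (cong₂ _+_ (δ-≢ w₀ x₁≢x) (δ-self x₁ w₁))
                                    (δ-≢ w₋₁ (λ e → x₋₁≢x₁ (sym e))))
                         (at (reset false false false) reset-x₁) ⟩
          ((0# + w₁) + 0#) + 0#  ≈⟨ ≈-trans (+-identityʳ _) (≈-trans (+-identityʳ _) (+-identityˡ _)) ⟩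
          w₁                     ≡⟨ sym (at (reset b₀ b₁ b₋₁) reset-x₁) ⟩
          when (reset b₀ b₁ b₋₁ x₁) (f x₁) ∎)
        ... | inj₂ (inj₂ (inj₁ refl)) = ≈-sym (begin
          ((δ x w₀ x₋₁ + δ x₁ w₁ x₋₁) + δ x₋₁ w₋₁ x₋₁) + when (reset false false false x₋₁) (f x₋₁)
            ≡⟨ cong₂ _+_ (cong₂ _+_ (cong₂ _+_ (δ-≢ w₀ x₋₁≢x) (δ-≢ w₁ x₋₁≢x₁)) (δ-self x₋₁ w₋₁))
                         (at (reset false false false) reset-x₋₁) ⟩
          ((0# + 0#) + w₋₁) + 0#  ≈⟨ ≈-trans (+-identityʳ _) (≈-trans (+-congʳ (+-identityˡ 0#)) (+-identityˡ w₋₁)) ⟩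
          w₋₁                     ≡⟨ sym (at (reset b₀ b₁ b₋₁) reset-x₋₁) ⟩
          when (reset b₀ b₁ b₋₁ x₋₁) (f x₋₁) ∎)
        ... | inj₂ (inj₂ (inj₂ out@(z≢x , z≢x₁ , z≢x₋₁))) = begin
          when (reset b₀ b₁ b₋₁ z) (f z)   ≡⟨ at (reset b₀ b₁ b₋₁) (reset-outside out) ⟩
          when (E z) (f z)                 ≈⟨ ≈-sym (+-identityˡ _) ⟩
          0# + when (E z) (f z)            ≈⟨ +-congʳ (≈-sym (≈-trans (+-identityʳ _) (+-identityʳ 0#))) ⟩
          ((0# + 0#) + 0#) + when (E z) (f z)
            ≡⟨ sym (cong₂ _+_ (cong₂ _+_ (cong₂ _+_ (δ-≢ _ z≢x) (δ-≢ _ z≢x₁)) (δ-≢ _ z≢x₋₁))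
                              (at (reset false false false) (reset-outside out))) ⟩
          ((δ x w₀ z + δ x₁ w₁ z) + δ x₋₁ w₋₁ z) + when (reset false false false z) (f z) ∎

        weight-reset : weight F f (reset b₀ b₁ b₋₁) ≈ ((w₀ + w₁) + w₋₁) + weight F f (reset false false false)
        weight-reset = begin
          weight F f (reset b₀ b₁ b₋₁)                 ≡⟨ Σᶠ≡sum (λ z → when (reset b₀ b₁ b₋₁ z) (f z)) ⟩
          sum (λ z → when (reset b₀ b₁ b₋₁ z) (f z))   ≈⟨ sum-cong-≋ when-reset ⟩
          sum (λ z → ((δ x w₀ z + δ x₁ w₁ z) + δ x₋₁ w₋₁ z) + when (reset false false false z) (f z))
                                                       ≈⟨ sum-δ³ x x₁ x₋₁ w₀ w₁ w₋₁ _ ⟩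
          ((w₀ + w₁) + w₋₁) + sum (λ z → when (reset false false false z) (f z))
            ≡⟨ cong (((w₀ + w₁) + w₋₁) +_) (sym (Σᶠ≡sum (λ z → when (reset false false false z) (f z)))) ⟩
          ((w₀ + w₁) + w₋₁) + weight F f (reset false false false) ∎

      reset-balance : WellCovered F G f → ∀ {b₀ b₁ b₋₁ b₀′ b₁′ b₋₁′} →
        LocallyMaximal (reset b₀ b₁ b₋₁) → LocallyMaximal (reset b₀′ b₁′ b₋₁′) →
        (when b₀ (f x) + when b₁ (f x₁)) + when b₋₁ (f x₋₁)
        ≈ (when b₀′ (f x) + when b₁′ (f x₁)) + when b₋₁′ (f x₋₁)
      reset-balance wc {b₀} {b₁} {b₋₁} {b₀′} {b₁′} {b₋₁′} maximal maximal′ =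
        ∙-cancelʳ (weight F f (reset false false false)) _ _ (begin
          _                               ≈⟨ ≈-sym (weight-reset b₀ b₁ b₋₁) ⟩
          weight F f (reset b₀ b₁ b₋₁)    ≈⟨ wc _ _ (locallyMaximal⇒maximalIndependent _ maximal)
                                                    (locallyMaximal⇒maximalIndependent _ maximal′) ⟩
          weight F f (reset b₀′ b₁′ b₋₁′) ≈⟨ weight-reset b₀′ b₁′ b₋₁′ ⟩
          _                               ∎)

    module _ (f : Fin n → Carrier) (wc : WellCovered F G f) where
      -- With x₃, x₋₃ ∈ E, putting either x or both x₁, x₋₁ into the window gives a maximal independent set.
      recurrence : ∀ {x y} → x ~ y → f x ≈ f y + f (other y x)
      recurrence {x} x~y = balance (extend-pair x₃≁x₋₃)
        where
        open Window x~y
        balance : (∃[ E ] LocallyMaximal E × E x₃ ≡ true × E x₋₃ ≡ true) → f x ≈ f x₁ + f x₋₁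
        balance (E , E-maximal , E₃ , E₋₃) = begin
          f x                   ≈⟨ ≈-sym (≈-trans (+-identityʳ _) (+-identityʳ _)) ⟩
          (f x + 0#) + 0#
            ≈⟨ WindowWeights.reset-balance x~y E f wc (maximal {true} {false} {false} refl refl refl refl refl)
                                                      (maximal {false} {true} {true} refl refl refl refl refl) ⟩
          (0# + f x₁) + f x₋₁   ≈⟨ +-congʳ (+-identityˡ _) ⟩
          f x₁ + f x₋₁          ∎
          where
          open Reset E
          maximal : ∀ {b₀ b₁ b₋₁} → maximalAt b₀ b₁ b₋₁ ≡ true →
                    maximalAt b₁ b₀ false ≡ true → maximalAt b₋₁ b₀ false ≡ true →
                    maximalAt false b₁ true ≡ true → maximalAt false b₋₁ true ≡ true →
                    LocallyMaximal (reset b₀ b₁ b₋₁)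
          maximal = reset-maximal E-maximal (member⇒nbr-out E E-maximal E₃ (~-sym x₂~x₃))
                                            (member⇒nbr-out E E-maximal E₋₃ (~-sym x₋₂~x₋₃)) E₃ E₋₃

      -- Off the hexagons x₋₂ and x₃ are non-adjacent; with both in E, x and x₁ are interchangeable.
      hexagonFree⇒flat : ∀ {x y} → HexagonFree x → x ~ y → f x ≈ f y
      hexagonFree⇒flat {x} free x~y = balance (extend-pair (hexagonFree⇒x₋₂≁x₃ free))
        where
        open Window x~y
        balance : (∃[ E ] LocallyMaximal E × E x₋₂ ≡ true × E x₃ ≡ true) → f x ≈ f x₁
        balance (E , E-maximal , E₋₂ , E₃) = begin
          f x                   ≈⟨ ≈-sym (≈-trans (+-identityʳ _) (+-identityʳ _)) ⟩
          (f x + 0#) + 0#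
            ≈⟨ WindowWeights.reset-balance x~y E f wc (maximal {true} {false} {false} refl refl refl refl refl)
                                                      (maximal {false} {true} {false} refl refl refl refl refl) ⟩
          (0# + f x₁) + 0#      ≈⟨ ≈-trans (+-identityʳ _) (+-identityˡ _) ⟩
          f x₁                  ∎
          where
          open Reset E
          maximal : ∀ {b₀ b₁ b₋₁} → maximalAt b₀ b₁ b₋₁ ≡ true →
                    maximalAt b₁ b₀ false ≡ true → maximalAt b₋₁ b₀ true ≡ true →
                    maximalAt false b₁ true ≡ true → maximalAt true b₋₁ false ≡ true →
                    LocallyMaximal (reset b₀ b₁ b₋₁)
          maximal = reset-maximal E-maximal (member⇒nbr-out E E-maximal E₃ (~-sym x₂~x₃)) E₋₂ E₃
                                            (member⇒nbr-out E E-maximal E₋₂ x₋₂~x₋₃)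

      recurrence-at : ∀ {x a b} → x ~ a → x ~ b → a ≢ b → f x ≈ f a + f b
      recurrence-at {x} {a} xa xb a≢b =
        ≈-trans (recurrence xa) (+-congˡ (≈-reflexive (cong f (sym (other-unique xa xb (λ e → a≢b (sym e)))))))

      hexagonFree⇒zero : ∀ {x} → HexagonFree x → f x ≈ 0#
      hexagonFree⇒zero {x} free = x+x≈x⇒x≈0 (f x) (≈-sym (begin
        f x                    ≈⟨ recurrence-at (adj-nbr₁ x) (adj-nbr₂ x) (nbr₁≢nbr₂ x) ⟩
        f (nbr₁ x) + f (nbr₂ x) ≈⟨ ≈-sym (+-cong (hexagonFree⇒flat free (adj-nbr₁ x))
                                                 (hexagonFree⇒flat free (adj-nbr₂ x))) ⟩
        f x + f x              ∎))

    module HexagonBasis (H : Hexagon) where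
      open Hexagon H
      open HexagonWalks H using (prev-adj)

      basisVector : Fin 2 → Fin n → Carrier
      basisVector σ y = sum (λ j → δ (vertex j) (value (hexSign σ j)) y)

      basisVector-vertex : ∀ σ a → basisVector σ (vertex a) ≈ value (hexSign σ a)
      basisVector-vertex σ a =
        ≈-trans (sum-single (λ j → δ (vertex j) (value (hexSign σ j)) (vertex a)) a
                  (λ j j≢a → ≈-reflexive (δ-≢ (value (hexSign σ j)) (λ e → j≢a (vertex-injective (sym e))))))
                (≈-reflexive (δ-self (vertex a) (value (hexSign σ a))))

      basisVector-off : ∀ σ {y} → (∀ j → y ≢ vertex j) → basisVector σ y ≈ 0#
      basisVector-off σ {y} y∉ = sum-zero (λ j → δ (vertex j) (value (hexSign σ j)) y)
                                         (λ j → ≈-reflexive (δ-≢ (value (hexSign σ j)) (y∉ j)))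

      when-sum : ∀ {k} b (g : Fin k → Carrier) → when b (sum g) ≈ sum (λ j → when b (g j))
      when-sum true  g = ≈-refl
      when-sum false g = ≈-sym (sum-zero (λ j → when false (g j)) (λ _ → ≈-refl))

      weight-basisVector : ∀ σ M → weight F (basisVector σ) M ≈ sum (λ j → when (M (vertex j)) (value (hexSign σ j)))
      weight-basisVector σ M = begin
        weight F (basisVector σ) M                                     ≡⟨ Σᶠ≡sum (λ y → when (M y) (basisVector σ y)) ⟩
        sum (λ y → when (M y) (basisVector σ y))
          ≈⟨ sum-cong-≋ (λ y → when-sum (M y) (λ j → δ (vertex j) (v j) y)) ⟩
        sum (λ y → sum (λ j → when (M y) (δ (vertex j) (v j) y)))
          ≈⟨ ∑-comm (λ y j → when (M y) (δ (vertex j) (v j) y)) ⟩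
        sum (λ j → sum (λ y → when (M y) (δ (vertex j) (v j) y)))      ≈⟨ sum-cong-≋ at-vertex ⟩
        sum (λ j → when (M (vertex j)) (v j))                          ∎
        where
        v : Fin 6 → Carrier
        v j = value (hexSign σ j)
        when-0 : ∀ b → when b 0# ≈ 0#
        when-0 true  = ≈-refl
        when-0 false = ≈-refl
        at-vertex : ∀ j → sum (λ y → when (M y) (δ (vertex j) (v j) y)) ≈ when (M (vertex j)) (v j)
        at-vertex j = ≈-trans (sum-single (λ y → when (M y) (δ (vertex j) (v j) y)) (vertex j)
                                          (λ y y≢ → ≈-trans (≈-reflexive (cong (when (M y)) (δ-≢ (v j) y≢)))
                                                                          (when-0 (M y))))
                              (≈-reflexive (cong (when (M (vertex j))) (δ-self (vertex j) (v j))))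

      maximal-pattern : ∀ M → LocallyMaximal M → MaximalPattern (λ j → M (vertex j))
      maximal-pattern M maximal i =
        trans (sym (maximalAt-nbrs M (vertex-adj i) (~-sym (prev-adj i)) (λ e → next≢prev i (vertex-injective e))))
              (maximal (vertex i))

      weight-basisVector≈0 : ∀ σ M → MaximalIndependent G M → weight F (basisVector σ) M ≈ 0#
      weight-basisVector≈0 σ M mis = ≈-trans (weight-basisVector σ M)
        (balanced⇒signed-sum≈0 σ (λ j → M (vertex j)) (maximalPattern⇒balanced σ (λ j → M (vertex j))
          (maximal-pattern M (maximalIndependent⇒locallyMaximal M mis))))

      basisVector-wellCovered : ∀ σ → WellCovered F G (basisVector σ)
      basisVector-wellCovered σ M M′ mis mis′ =
        ≈-trans (weight-basisVector≈0 σ M mis) (≈-sym (weight-basisVector≈0 σ M′ mis′))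

    module FromDecomposition {m} (D : HexagonDecomposition m) where
      open HexagonDecomposition D
      open Hexagon
      open HexagonBasis using (basisVector; basisVector-vertex; basisVector-off; basisVector-wellCovered)

      index : Fin 2 → Fin m → Fin (2 ℕ.* m)
      index = combine

      basis : Fin (2 ℕ.* m) → Fin n → Carrier
      basis i = basisVector (hexagon (proj₂ (remQuot {2} m i))) (proj₁ (remQuot {2} m i))

      basis-index : ∀ σ t y → basis (index σ t) y ≡ basisVector (hexagon t) σ y
      basis-index σ t y = cong (λ (σ′ , t′) → basisVector (hexagon t′) σ′ y) (remQuot-combine σ t)

      decode : ∀ i → ∃ λ (σ : Fin 2) → ∃ λ (t : Fin m) → index σ t ≡ i
      decode i = proj₁ (remQuot {2} m i) , proj₂ (remQuot {2} m i) , Fin.combine-remQuot {2} m i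

      index-0≢1 : ∀ t → index 0F t ≢ index 1F t
      index-0≢1 t e with trans (sym (remQuot-combine 0F t)) (trans (cong (remQuot {2} m) e) (remQuot-combine 1F t))
      ... | ()

      lincomb-vertex : ∀ α t a → lincomb F α basis (vertex (hexagon t) a)
        ≈ α (index 0F t) * value (hexSign 0F a) + α (index 1F t) * value (hexSign 1F a)
      lincomb-vertex α t a = begin
        lincomb F α basis y                          ≡⟨ Σᶠ≡sum (λ i → α i * basis i y) ⟩
        sum (λ i → α i * basis i y)                  ≈⟨ sum-pair (λ i → α i * basis i y) (index-0≢1 t) other-terms ⟩
        α c₀ * basis c₀ y + α c₁ * basis c₁ y       ≈⟨ +-cong (*-congˡ (at-own 0F)) (*-congˡ (at-own 1F)) ⟩
        α c₀ * value (hexSign 0F a) + α c₁ * value (hexSign 1F a) ∎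
        where
        y : Fin n
        y = vertex (hexagon t) a
        c₀ c₁ : Fin (2 ℕ.* m)
        c₀ = index 0F t
        c₁ = index 1F t
        at-own : ∀ σ → basis (index σ t) y ≈ value (hexSign σ a)
        at-own σ = ≈-trans (≈-reflexive (basis-index σ t y)) (basisVector-vertex (hexagon t) σ a)
        off : ∀ σ t′ → index σ t′ ≢ c₀ → index σ t′ ≢ c₁ → ∀ j → y ≢ vertex (hexagon t′) j
        off 0F t′ ≢c₀ _ j e with disjoint e
        ... | refl = ≢c₀ refl
        off 1F t′ _ ≢c₁ j e with disjoint e
        ... | refl = ≢c₁ refl
        other-terms : ∀ i → i ≢ c₀ → i ≢ c₁ → α i * basis i y ≈ 0#
        other-terms i i≢c₀ i≢c₁ with decode i
        ... | σ , t′ , refl = ≈-trans (*-congˡ (≈-trans (≈-reflexive (basis-index σ t′ y))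
                                 (basisVector-off (hexagon t′) σ (off σ t′ i≢c₀ i≢c₁)))) (zeroʳ _)

      lincomb-free : ∀ α {y} → HexagonFree y → lincomb F α basis y ≈ 0#
      lincomb-free α {y} free = ≈-trans (≈-reflexive (Σᶠ≡sum (λ i → α i * basis i y)))
                                        (sum-zero (λ i → α i * basis i y) term≈0)
        where
        term≈0 : ∀ i → α i * basis i y ≈ 0#
        term≈0 i with decode i
        ... | σ , t , refl = ≈-trans (*-congˡ (≈-trans (≈-reflexive (basis-index σ t y))
                               (basisVector-off (hexagon t) σ (λ j e → free (hexagon t , j , e))))) (zeroʳ _)

      independent : ∀ α → (∀ y → lincomb F α basis y ≈ 0#) → ∀ i → α i ≈ 0#
      independent α vanishes i with decode i
      ... | 0F , t , refl = ≈-trans (≈-sym (≈-trans (lincomb-vertex α t 0F)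
                              (≈-trans (+-cong (*-value _ pos) (*-value _ null)) (+-identityʳ _)))) (vanishes _)
      ... | 1F , t , refl = ≈-trans (≈-sym (≈-trans (lincomb-vertex α t 1F)
                              (≈-trans (+-cong (*-value _ null) (*-value _ pos)) (+-identityˡ _)))) (vanishes _)

      spanning : ∀ f → WellCovered F G f → ∃[ α ] ∀ y → f y ≈ lincomb F α basis y
      spanning f wc = α , reconstruct
        where
        α : Fin (2 ℕ.* m) → Carrier
        α i = f (vertex (hexagon (proj₂ (remQuot {2} m i))) (proj₁ (remQuot {2} m i) ↑ˡ 4))
        α-index : ∀ σ t → α (index σ t) ≡ f (vertex (hexagon t) (σ ↑ˡ 4))
        α-index σ t = cong (λ (σ′ , t′) → f (vertex (hexagon t′) (σ′ ↑ˡ 4))) (remQuot-combine σ t)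
        reconstruct : ∀ y → f y ≈ lincomb F α basis y
        reconstruct y with covers y
        ... | inj₂ free = ≈-trans (hexagonFree⇒zero f wc free) (≈-sym (lincomb-free α free))
        ... | inj₁ (t , a , refl) = ≈-sym (begin
          lincomb F α basis (v a)                                        ≈⟨ lincomb-vertex α t a ⟩
          α (index 0F t) * value (hexSign 0F a) + α (index 1F t) * value (hexSign 1F a)
            ≡⟨ cong₂ _+_ (cong (_* value (hexSign 0F a)) (α-index 0F t)) (cong (_* value (hexSign 1F a)) (α-index 1F t)) ⟩
          f (v 0F) * value (hexSign 0F a) + f (v 1F) * value (hexSign 1F a) ≈⟨ hexagon-recurrence-solution (λ j → f (v j)) rec a ⟩
          f (v a)                                                        ∎)
          where
          v : Fin 6 → Fin n
          v = vertex (hexagon t)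
          rec : ∀ i → f (v i) ≈ f (v (next i)) + f (v (prev i))
          rec i = recurrence-at f wc (vertex-adj (hexagon t) i) (~-sym (HexagonWalks.prev-adj (hexagon t) i))
                                (λ e → next≢prev i (vertex-injective (hexagon t) e))

      wcdim : wcdim≡ F G (2 ℕ.* m)
      wcdim = basis
            , (λ i → basisVector-wellCovered (hexagon (proj₂ (remQuot {2} m i))) (proj₁ (remQuot {2} m i)))
            , independent
            , spanning

module LeviGraph {v} (C : V2Config v) where
  open V2Config C

  Vertex : Set
  Vertex = Fin v ⊎ Fin v

  incidence : Vertex → Vertex → Bool
  incidence (inj₁ p) (inj₂ l) = inc p l
  incidence (inj₂ l) (inj₁ p) = inc p l
  incidence (inj₁ _) (inj₁ _) = false
  incidence (inj₂ _) (inj₂ _) = false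

  leviAdj≡incidence : ∀ x y → leviAdj C x y ≡ incidence (splitAt v x) (splitAt v y)
  leviAdj≡incidence x y with splitAt v x | splitAt v y
  ... | inj₁ _ | inj₁ _ = refl
  ... | inj₁ _ | inj₂ _ = refl
  ... | inj₂ _ | inj₁ _ = refl
  ... | inj₂ _ | inj₂ _ = refl

  incidence-sym : ∀ u w → incidence u w ≡ incidence w u
  incidence-sym (inj₁ _) (inj₁ _) = refl
  incidence-sym (inj₁ _) (inj₂ _) = refl
  incidence-sym (inj₂ _) (inj₁ _) = refl
  incidence-sym (inj₂ _) (inj₂ _) = refl

  isPoint : Vertex → Bool
  isPoint (inj₁ _) = true
  isPoint (inj₂ _) = false

  incidence-isPoint : ∀ u w → incidence u w ≡ true → isPoint w ≡ not (isPoint u)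
  incidence-isPoint (inj₁ _) (inj₂ _) _ = refl
  incidence-isPoint (inj₂ _) (inj₁ _) _ = refl

  common-nbrs : ∀ {u w b d} → incidence u b ≡ true → incidence u d ≡ true →
                incidence w b ≡ true → incidence w d ≡ true → u ≢ w → b ≡ d
  common-nbrs {inj₁ p} {inj₁ q} {inj₂ l} {inj₂ l′} pl pl′ ql ql′ p≢q =
    cong inj₂ (count≤1⇒unique (λ k → inc p k ∧ inc q k) (points-meet p q (λ e → p≢q (cong inj₁ e)))
                 (cong₂ _∧_ pl ql) (cong₂ _∧_ pl′ ql′))
  common-nbrs {inj₂ l} {inj₂ m} {inj₁ p} {inj₁ p′} pl p′l pm p′m l≢m =
    cong inj₁ (count≤1⇒unique (λ k → inc k l ∧ inc k m) (lines-meet l m (λ e → l≢m (cong inj₂ e)))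
                 (cong₂ _∧_ pl pm) (cong₂ _∧_ p′l p′m))

  lines-through : ∀ p → ExactlyTwo (λ l → inc p l)
  lines-through p = count≡2⇒exactlyTwo (λ l → inc p l) (point-two p)

  points-on : ∀ l → ExactlyTwo (λ p → inc p l)
  points-on l = count≡2⇒exactlyTwo (λ p → inc p l) (line-two l)

  nbrs : Vertex → Vertex × Vertex
  nbrs (inj₁ p) = let open ExactlyTwo (lines-through p) in inj₂ fst , inj₂ snd
  nbrs (inj₂ l) = let open ExactlyTwo (points-on l) in inj₁ fst , inj₁ snd

  incidence-nbr₁ : ∀ u → incidence u (proj₁ (nbrs u)) ≡ true
  incidence-nbr₁ (inj₁ p) = ExactlyTwo.P-fst (lines-through p)
  incidence-nbr₁ (inj₂ l) = ExactlyTwo.P-fst (points-on l)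

  incidence-nbr₂ : ∀ u → incidence u (proj₂ (nbrs u)) ≡ true
  incidence-nbr₂ (inj₁ p) = ExactlyTwo.P-snd (lines-through p)
  incidence-nbr₂ (inj₂ l) = ExactlyTwo.P-snd (points-on l)

  nbrs-distinct : ∀ u → proj₁ (nbrs u) ≢ proj₂ (nbrs u)
  nbrs-distinct (inj₁ p) e = ExactlyTwo.fst≢snd (lines-through p) (Sum.inj₂-injective e)
  nbrs-distinct (inj₂ l) e = ExactlyTwo.fst≢snd (points-on l) (Sum.inj₁-injective e)

  incidence⇒nbr : ∀ u w → incidence u w ≡ true → w ≡ proj₁ (nbrs u) ⊎ w ≡ proj₂ (nbrs u)
  incidence⇒nbr (inj₁ p) (inj₂ l) e = Sum.map (cong inj₂) (cong inj₂) (ExactlyTwo.fst-or-snd (lines-through p) l e)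
  incidence⇒nbr (inj₂ l) (inj₁ p) e = Sum.map (cong inj₁) (cong inj₁) (ExactlyTwo.fst-or-snd (points-on l) p e)

  vertex : Vertex → Fin (v ℕ.+ v)
  vertex = join v v

  leviAdj-vertex : ∀ x u → leviAdj C x (vertex u) ≡ incidence (splitAt v x) u
  leviAdj-vertex x u = trans (leviAdj≡incidence x (vertex u)) (cong (incidence (splitAt v x)) (Fin.splitAt-join v v u))

  levi-twoRegularGirth6 : TwoRegularGirth6 (Levi C)
  levi-twoRegularGirth6 = record
    { nbr₁       = λ x → vertex (proj₁ (nbrs (splitAt v x)))
    ; nbr₂       = λ x → vertex (proj₂ (nbrs (splitAt v x)))
    ; adj-nbr₁   = λ x → trans (leviAdj-vertex x _) (incidence-nbr₁ (splitAt v x))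
    ; adj-nbr₂   = λ x → trans (leviAdj-vertex x _) (incidence-nbr₂ (splitAt v x))
    ; nbr₁≢nbr₂  = λ x e → nbrs-distinct (splitAt v x)
                     (trans (sym (Fin.splitAt-join v v _)) (trans (cong (splitAt v) e) (Fin.splitAt-join v v _)))
    ; adj⇒nbr    = λ x y e → Sum.map (λ e′ → splitAt-injective v (trans e′ (sym (Fin.splitAt-join v v _))))
                                     (λ e′ → splitAt-injective v (trans e′ (sym (Fin.splitAt-join v v _))))
                                     (incidence⇒nbr (splitAt v x) (splitAt v y) (trans (sym (leviAdj≡incidence x y)) e))
    ; colour     = λ x → isPoint (splitAt v x)
    ; adj⇒colour = λ x y e → incidence-isPoint (splitAt v x) (splitAt v y) (trans (sym (leviAdj≡incidence x y)) e)
    ; no-4-cycle = λ a b c d ab bc cd da a≢c b≢d → b≢d (splitAt-injective v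
        (common-nbrs (adj ab) (trans (incidence-sym (splitAt v a) (splitAt v d)) (adj da))
                     (trans (incidence-sym (splitAt v c) (splitAt v b)) (adj bc)) (adj cd)
                     (λ e → a≢c (splitAt-injective v e))))
    }
    where
    adj : ∀ {x y} → leviAdj C x y ≡ true → incidence (splitAt v x) (splitAt v y) ≡ true
    adj {x} {y} e = trans (sym (leviAdj≡incidence x y)) e

levi-embedding : ∀ {v w} (C : V2Config v) (D : V2Config w) (φ : LeviGraph.Vertex C → LeviGraph.Vertex D) →
  (∀ {u u′} → φ u ≡ φ u′ → u ≡ u′) →
  (∀ u u′ → LeviGraph.incidence D (φ u) (φ u′) ≡ LeviGraph.incidence C u u′) →
  (∀ u s → LeviGraph.incidence D (φ u) s ≡ true → ∃[ u′ ] φ u′ ≡ s) →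
  ComponentEmbedding (Levi C) (Levi D)
levi-embedding {v} {w} C D φ φ-injective φ-incidence φ-closed = record
  { embed           = embed
  ; embed-injective = λ e → splitAt-injective v (φ-injective (join-injective w e))
  ; embed-adj       = λ x y → begin
      leviAdj D (embed x) (embed y)                        ≡⟨ LD.leviAdj≡incidence (embed x) (embed y) ⟩
      LD.incidence (splitAt w (embed x)) (splitAt w (embed y))
        ≡⟨ cong₂ LD.incidence (Fin.splitAt-join w w (φ (splitAt v x))) (Fin.splitAt-join w w (φ (splitAt v y))) ⟩
      LD.incidence (φ (splitAt v x)) (φ (splitAt v y))     ≡⟨ φ-incidence (splitAt v x) (splitAt v y) ⟩
      LC.incidence (splitAt v x) (splitAt v y)             ≡⟨ sym (LC.leviAdj≡incidence x y) ⟩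
      leviAdj C x y                                        ∎
  ; embed-closed    = λ x z e →
      let u′ , φu′≡ = φ-closed (splitAt v x) (splitAt w z)
                        (trans (cong (λ s → LD.incidence s (splitAt w z)) (sym (Fin.splitAt-join w w (φ (splitAt v x)))))
                               (trans (sym (LD.leviAdj≡incidence (embed x) z)) e))
      in join v v u′ , trans (cong (λ s → join w w (φ s)) (Fin.splitAt-join v v u′))
                             (trans (cong (join w w) φu′≡) (Fin.join-splitAt w w z))
  }
  where
  open ≡-Reasoning
  module LC = LeviGraph C
  module LD = LeviGraph D
  embed : Fin (v ℕ.+ v) → Fin (w ℕ.+ w)
  embed x = join w w (φ (splitAt v x))

≤1+≡0 : ∀ {x y} → x ≤ 1 → y ≡ 0 → x ℕ.+ y ≤ 1
≤1+≡0 {x} x≤1 refl = subst (_≤ 1) (sym (ℕ.+-identityʳ x)) x≤1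

≡0+≤1 : ∀ {x y} → x ≡ 0 → y ≤ 1 → x ℕ.+ y ≤ 1
≡0+≤1 refl y≤1 = y≤1

module ConfigurationSum {a b} (X : V2Config a) (Y : V2Config b) where
  module X = V2Config X
  module Y = V2Config Y

  Index : Set
  Index = Fin a ⊎ Fin b

  sumInc : Index → Index → Bool
  sumInc (inj₁ p) (inj₁ l) = X.inc p l
  sumInc (inj₂ p) (inj₂ l) = Y.inc p l
  sumInc (inj₁ _) (inj₂ _) = false
  sumInc (inj₂ _) (inj₁ _) = false

  lines-two : ∀ l → count (λ p → sumInc (inj₁ p) l) ℕ.+ count (λ p → sumInc (inj₂ p) l) ≡ 2
  lines-two (inj₁ l) = cong₂ ℕ._+_ (X.line-two l) (count-none {b})
  lines-two (inj₂ l) = cong₂ ℕ._+_ (count-none {a}) (Y.line-two l)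

  points-two : ∀ p → count (λ l → sumInc p (inj₁ l)) ℕ.+ count (λ l → sumInc p (inj₂ l)) ≡ 2
  points-two (inj₁ p) = cong₂ ℕ._+_ (X.point-two p) (count-none {b})
  points-two (inj₂ p) = cong₂ ℕ._+_ (count-none {a}) (Y.point-two p)

  points-meet : ∀ p q → p ≢ q → count (λ l → sumInc p (inj₁ l) ∧ sumInc q (inj₁ l))
                                 ℕ.+ count (λ l → sumInc p (inj₂ l) ∧ sumInc q (inj₂ l)) ≤ 1
  points-meet (inj₁ p) (inj₁ q) p≢q =
    ≤1+≡0 (X.points-meet p q (λ e → p≢q (cong inj₁ e))) (count-none {b})
  points-meet (inj₁ p) (inj₂ q) _ =
    ≤1+≡0 (count-∧false≤1 (λ l → X.inc p l)) (count-none {b})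
  points-meet (inj₂ p) (inj₁ q) _ =
    ≡0+≤1 (count-none {a}) (count-∧false≤1 (λ l → Y.inc p l))
  points-meet (inj₂ p) (inj₂ q) p≢q =
    ≡0+≤1 (count-none {a}) (Y.points-meet p q (λ e → p≢q (cong inj₂ e)))

  lines-meet : ∀ l m → l ≢ m → count (λ p → sumInc (inj₁ p) l ∧ sumInc (inj₁ p) m)
                                ℕ.+ count (λ p → sumInc (inj₂ p) l ∧ sumInc (inj₂ p) m) ≤ 1
  lines-meet (inj₁ l) (inj₁ m) l≢m =
    ≤1+≡0 (X.lines-meet l m (λ e → l≢m (cong inj₁ e))) (count-none {b})
  lines-meet (inj₁ l) (inj₂ m) _ =
    ≤1+≡0 (count-∧false≤1 (λ p → X.inc p l)) (count-none {b})
  lines-meet (inj₂ l) (inj₁ m) _ =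
    ≡0+≤1 (count-none {a}) (count-∧false≤1 (λ p → Y.inc p l))
  lines-meet (inj₂ l) (inj₂ m) l≢m =
    ≡0+≤1 (count-none {a}) (Y.lines-meet l m (λ e → l≢m (cong inj₂ e)))

  sum : V2Config (a ℕ.+ b)
  sum = record
    { four≤v      = ℕ.≤-trans X.four≤v (ℕ.m≤m+n a b)
    ; inc         = λ p l → sumInc (splitAt a p) (splitAt a l)
    ; line-two    = λ l → trans (count-splitAt a (λ p → sumInc p (splitAt a l))) (lines-two (splitAt a l))
    ; point-two   = λ p → trans (count-splitAt a (λ l → sumInc (splitAt a p) l)) (points-two (splitAt a p))
    ; points-meet = λ p q p≢q → subst (_≤ 1)
        (sym (count-splitAt a (λ l → sumInc (splitAt a p) l ∧ sumInc (splitAt a q) l)))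
        (points-meet (splitAt a p) (splitAt a q) (λ e → p≢q (splitAt-injective a e)))
    ; lines-meet  = λ l m l≢m → subst (_≤ 1)
        (sym (count-splitAt a (λ p → sumInc p (splitAt a l) ∧ sumInc p (splitAt a m))))
        (lines-meet (splitAt a l) (splitAt a m) (λ e → l≢m (splitAt-injective a e)))
    }

  module LX = LeviGraph X
  module LY = LeviGraph Y
  module LS = LeviGraph sum

  toLeft : LX.Vertex → LS.Vertex
  toLeft = Sum.map (_↑ˡ b) (_↑ˡ b)

  toRight : LY.Vertex → LS.Vertex
  toRight = Sum.map (a ↑ʳ_) (a ↑ʳ_)

  toLeft-injective : ∀ {u u′} → toLeft u ≡ toLeft u′ → u ≡ u′
  toLeft-injective {inj₁ _} {inj₁ _} e = cong inj₁ (Fin.↑ˡ-injective b _ _ (Sum.inj₁-injective e))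
  toLeft-injective {inj₂ _} {inj₂ _} e = cong inj₂ (Fin.↑ˡ-injective b _ _ (Sum.inj₂-injective e))

  toRight-injective : ∀ {u u′} → toRight u ≡ toRight u′ → u ≡ u′
  toRight-injective {inj₁ _} {inj₁ _} e = cong inj₁ (Fin.↑ʳ-injective a _ _ (Sum.inj₁-injective e))
  toRight-injective {inj₂ _} {inj₂ _} e = cong inj₂ (Fin.↑ʳ-injective a _ _ (Sum.inj₂-injective e))

  toLeft-incidence : ∀ u u′ → LS.incidence (toLeft u) (toLeft u′) ≡ LX.incidence u u′
  toLeft-incidence (inj₁ p) (inj₂ l) = cong₂ sumInc (Fin.splitAt-↑ˡ a p b) (Fin.splitAt-↑ˡ a l b)
  toLeft-incidence (inj₂ l) (inj₁ p) = cong₂ sumInc (Fin.splitAt-↑ˡ a p b) (Fin.splitAt-↑ˡ a l b)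
  toLeft-incidence (inj₁ _) (inj₁ _) = refl
  toLeft-incidence (inj₂ _) (inj₂ _) = refl

  toRight-incidence : ∀ u u′ → LS.incidence (toRight u) (toRight u′) ≡ LY.incidence u u′
  toRight-incidence (inj₁ p) (inj₂ l) = cong₂ sumInc (Fin.splitAt-↑ʳ a b p) (Fin.splitAt-↑ʳ a b l)
  toRight-incidence (inj₂ l) (inj₁ p) = cong₂ sumInc (Fin.splitAt-↑ʳ a b p) (Fin.splitAt-↑ʳ a b l)
  toRight-incidence (inj₁ _) (inj₁ _) = refl
  toRight-incidence (inj₂ _) (inj₂ _) = refl

  toLeft-closed : ∀ u s → LS.incidence (toLeft u) s ≡ true → ∃[ u′ ] toLeft u′ ≡ s
  toLeft-closed (inj₁ p) (inj₂ l) e with splitAt a l in split-l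
  ... | inj₁ l′ = inj₂ l′ , cong inj₂ (Fin.splitAt⁻¹-↑ˡ split-l)
  ... | inj₂ _ rewrite Fin.splitAt-↑ˡ a p b with e
  ...   | ()
  toLeft-closed (inj₂ l) (inj₁ p) e with splitAt a p in split-p
  ... | inj₁ p′ = inj₁ p′ , cong inj₁ (Fin.splitAt⁻¹-↑ˡ split-p)
  ... | inj₂ _ rewrite Fin.splitAt-↑ˡ a l b with e
  ...   | ()
  toLeft-closed (inj₁ _) (inj₁ _) ()
  toLeft-closed (inj₂ _) (inj₂ _) ()

  toRight-closed : ∀ u s → LS.incidence (toRight u) s ≡ true → ∃[ u′ ] toRight u′ ≡ s
  toRight-closed (inj₁ p) (inj₂ l) e with splitAt a l in split-l
  ... | inj₂ l′ = inj₂ l′ , cong inj₂ (Fin.splitAt⁻¹-↑ʳ split-l)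
  ... | inj₁ _ rewrite Fin.splitAt-↑ʳ a b p with e
  ...   | ()
  toRight-closed (inj₂ l) (inj₁ p) e with splitAt a p in split-p
  ... | inj₂ p′ = inj₁ p′ , cong inj₁ (Fin.splitAt⁻¹-↑ʳ split-p)
  ... | inj₁ _ rewrite Fin.splitAt-↑ʳ a b l with e
  ...   | ()
  toRight-closed (inj₁ _) (inj₁ _) ()
  toRight-closed (inj₂ _) (inj₂ _) ()

  ↑ˡ≢↑ʳ : ∀ (p : Fin a) (q : Fin b) → p ↑ˡ b ≢ a ↑ʳ q
  ↑ˡ≢↑ʳ p q e with trans (sym (Fin.splitAt-↑ˡ a p b)) (trans (cong (splitAt a) e) (Fin.splitAt-↑ʳ a b q))
  ... | ()

  toLeft≢toRight : ∀ u w → toLeft u ≢ toRight w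
  toLeft≢toRight (inj₁ p) (inj₁ q) e = ↑ˡ≢↑ʳ p q (Sum.inj₁-injective e)
  toLeft≢toRight (inj₂ p) (inj₂ q) e = ↑ˡ≢↑ʳ p q (Sum.inj₂-injective e)

  toLeft-or-toRight : ∀ s → (∃[ u ] toLeft u ≡ s) ⊎ (∃[ w ] toRight w ≡ s)
  toLeft-or-toRight (inj₁ p) with splitAt a p in split-p
  ... | inj₁ p′ = inj₁ (inj₁ p′ , cong inj₁ (Fin.splitAt⁻¹-↑ˡ split-p))
  ... | inj₂ p′ = inj₂ (inj₁ p′ , cong inj₁ (Fin.splitAt⁻¹-↑ʳ split-p))
  toLeft-or-toRight (inj₂ l) with splitAt a l in split-l
  ... | inj₁ l′ = inj₁ (inj₂ l′ , cong inj₂ (Fin.splitAt⁻¹-↑ˡ split-l))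
  ... | inj₂ l′ = inj₂ (inj₂ l′ , cong inj₂ (Fin.splitAt⁻¹-↑ʳ split-l))

  left : ComponentEmbedding (Levi X) (Levi sum)
  left = levi-embedding X sum toLeft toLeft-injective toLeft-incidence toLeft-closed

  right : ComponentEmbedding (Levi Y) (Levi sum)
  right = levi-embedding Y sum toRight toRight-injective toRight-incidence toRight-closed

  left≢right : ∀ x y → ComponentEmbedding.embed left x ≢ ComponentEmbedding.embed right y
  left≢right x y e = toLeft≢toRight (splitAt a x) (splitAt b y) (join-injective (a ℕ.+ b) e)

  left-or-right : ∀ z → (∃[ x ] ComponentEmbedding.embed left x ≡ z) ⊎ (∃[ y ] ComponentEmbedding.embed right y ≡ z)
  left-or-right z with toLeft-or-toRight (splitAt (a ℕ.+ b) z)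
  ... | inj₁ (u , e) = inj₁ (join a a u , trans (cong (join (a ℕ.+ b) (a ℕ.+ b))
                                (trans (cong toLeft (Fin.splitAt-join a a u)) e)) (Fin.join-splitAt (a ℕ.+ b) (a ℕ.+ b) z))
  ... | inj₂ (w , e) = inj₂ (join b b w , trans (cong (join (a ℕ.+ b) (a ℕ.+ b))
                                (trans (cong toRight (Fin.splitAt-join b b w)) e)) (Fin.join-splitAt (a ℕ.+ b) (a ℕ.+ b) z))

  sum-hexagons : ∀ {m k} → Cycles.HexagonDecomposition LX.levi-twoRegularGirth6 m
                         → Cycles.HexagonDecomposition LY.levi-twoRegularGirth6 k
                         → Cycles.HexagonDecomposition LS.levi-twoRegularGirth6 (m ℕ.+ k)
  sum-hexagons = HexagonUnion.union LX.levi-twoRegularGirth6 LY.levi-twoRegularGirth6 LS.levi-twoRegularGirth6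
                                    left right left≢right left-or-right

_⊕_ : ∀ {a b} → V2Config a → V2Config b → V2Config (a ℕ.+ b)
X ⊕ Y = ConfigurationSum.sum X Y

polygonal : ∀ {v} → (Fin v → Fin v) → Fin v → Fin v → Bool
polygonal σ p l = ⌊ p ≟ l ⌋ ∨ ⌊ p ≟ σ l ⌋

distinct-pairs : ∀ {v} {R : Fin v → Fin v → Set} → (∀ p q → p ≡ q ⊎ R p q) → ∀ p q → p ≢ q → R p q
distinct-pairs decided p q p≢q with decided p q
... | inj₁ p≡q = ⊥-elim (p≢q p≡q)
... | inj₂ r   = r

polygonalConfiguration : ∀ {v} (σ : Fin v → Fin v) → 4 ≤ v →
  True (all? λ l → count (λ p → polygonal σ p l) ℕ.≟ 2) →
  True (all? λ p → count (λ l → polygonal σ p l) ℕ.≟ 2) →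
  True (all? λ p → all? λ q → (p ≟ q) ⊎-dec (count (λ l → polygonal σ p l ∧ polygonal σ q l) ℕ.≤? 1)) →
  True (all? λ l → all? λ m → (l ≟ m) ⊎-dec (count (λ p → polygonal σ p l ∧ polygonal σ p m) ℕ.≤? 1)) →
  V2Config v
polygonalConfiguration σ four≤v lines points meet₁ meet₂ = record
  { four≤v      = four≤v
  ; inc         = polygonal σ
  ; line-two    = toWitness lines
  ; point-two   = toWitness points
  ; points-meet = distinct-pairs (toWitness meet₁)
  ; lines-meet  = distinct-pairs (toWitness meet₂)
  }

square-rotation : Fin 4 → Fin 4
square-rotation 0F = 1F
square-rotation 1F = 2F
square-rotation 2F = 3F
square-rotation 3F = 0F

square : V2Config 4
square = polygonalConfiguration square-rotation ℕ.≤-refl _ _ _ _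

-- A triangle alone has too few points to be a (v₂) configuration, so it comes with a square.
triangle-and-square-rotation : Fin 7 → Fin 7
triangle-and-square-rotation 0F = 1F
triangle-and-square-rotation 1F = 2F
triangle-and-square-rotation 2F = 0F
triangle-and-square-rotation 3F = 4F
triangle-and-square-rotation 4F = 5F
triangle-and-square-rotation 5F = 6F
triangle-and-square-rotation 6F = 3F

triangle-and-square : V2Config 7
triangle-and-square = polygonalConfiguration triangle-and-square-rotation (s≤s (s≤s (s≤s (s≤s z≤n)))) _ _ _ _

module SquareCycles = Cycles (LeviGraph.levi-twoRegularGirth6 square)
module TriangleAndSquareCycles = Cycles (LeviGraph.levi-twoRegularGirth6 triangle-and-square)

opaque
  unfolding SquareCycles.other TriangleAndSquareCycles.other

  square-leaders : count SquareCycles.isLeader ≡ 0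
  square-leaders = refl

  triangle-and-square-leaders : count TriangleAndSquareCycles.isLeader ≡ 1
  triangle-and-square-leaders = refl

square-hexagons : SquareCycles.HexagonDecomposition 0
square-hexagons = subst SquareCycles.HexagonDecomposition square-leaders (proj₂ SquareCycles.hexagon-decomposition)

triangle-and-square-hexagons : TriangleAndSquareCycles.HexagonDecomposition 1
triangle-and-square-hexagons = subst TriangleAndSquareCycles.HexagonDecomposition triangle-and-square-leaders
                                     (proj₂ TriangleAndSquareCycles.hexagon-decomposition)

record HexagonalConfiguration (n : ℕ) : Set where
  field
    {v}      : ℕ
    config   : V2Config v
    hexagons : Cycles.HexagonDecomposition (LeviGraph.levi-twoRegularGirth6 config) n

hexagonal-family : ∀ n → HexagonalConfiguration n
hexagonal-family zero    = record { config = square ; hexagons = square-hexagons }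
hexagonal-family (suc n) = record
  { config   = triangle-and-square ⊕ config
  ; hexagons = ConfigurationSum.sum-hexagons triangle-and-square config triangle-and-square-hexagons hexagons
  }
  where open HexagonalConfiguration (hexagonal-family n)

open import Data.Nat using (_*_)

wcdim-of-decomposition : ∀ {c ℓ} (F : Field c ℓ) {v} (C : V2Config v) {m} →
  Cycles.HexagonDecomposition (LeviGraph.levi-twoRegularGirth6 C) m → wcdim≡ F (Levi C) (2 * m)
wcdim-of-decomposition F C = Weightings.OnCycles.FromDecomposition.wcdim F (LeviGraph.levi-twoRegularGirth6 C)

wcdim-even : ∀ {c ℓ} (F : Field c ℓ) {v} (C : V2Config v) → Σ ℕ (λ k → wcdim≡ F (Levi C) (2 * k))
wcdim-even F C = let m , D = Cycles.hexagon-decomposition (LeviGraph.levi-twoRegularGirth6 C)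
                 in m , wcdim-of-decomposition F C D

configuration-with-wcdim : ∀ n → ConfigWithWcdim n
configuration-with-wcdim n = record { config = config ; dim = λ F → wcdim-of-decomposition F config hexagons }
  where open HexagonalConfiguration (hexagonal-family n)

corollary3p2 :
    (∀ {c ℓ} (F : Field c ℓ) {v : ℕ} (C : V2Config v)
       → Σ ℕ (λ k → wcdim≡ F (Levi C) (2 * k)))
    ×ω
    (∀ (n : ℕ) → ConfigWithWcdim n)
corollary3p2 = wcdim-even ,ω configuration-with-wcdim
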